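{- Let $\mathcal{M}$ be a relational structure with domain $M$, $\mathcal{L}$ a logic, and $n\geq 1$. A relation $R\subseteq (M^\omega)^n$ of $\omega$-words is $\mathcal{M}$-$\mathcal{L}$-MSO definable if and only if it is $\mathcal{M}$-$\mathcal{L}$-Büchi recognizable (i.e. its convolution $L_R$ is accepted by an $\mathcal{M}$-$\mathcal{L}$-Büchi automaton over $M^n$). The transformations in both directions are effective.
   Context: Convolution: for $\alpha_1,\dots,\alpha_n\in M^\omega$, $\langle\alpha_1,\dots,\alpha_n\rangle\in (M^n)^\omega$ is the $\omega$-word whose $i$-th letter is $(\alpha_1(i),\dots,\alpha_n(i))$; for $R\subseteq(M^\omega)^n$, $L_R=\{\langle\alpha_1,\dots,\alpha_n\rangle:(\alpha_1,\dots,\alpha_n)\in R\}$. An $\mathcal{M}$-$\mathcal{L}$-Büchi automaton over $M^n$ is $\mathcal{B}=(Q,M^n,q_0,\Delta,F)$ with finite state set $Q$, initial state $q_0$, accepting set $F\subseteq Q$, and finite transition relation $\Delta\subseteq Q\times\Phi_n\times Q$, where $\Phi_n$ is the set of $\mathcal{L}$-formulas (over the signature of $\mathcal{M}$) with $n$ free variables. A run on $\alpha=\langle\alpha_1,\dots,\alpha_n\rangle$ is a state sequence $\rho(0)\rho(1)\cdots$ with $\rho(0)=q_0$ such that for each $i$ there is $(\rho(i),\phi,\rho(i+1))\in\Delta$ with $\mathcal{M}\models\phi[\alpha_1(i),\dots,\alpha_n(i)]$; it is successful if $\rho(i)\in F$ for infinitely many $i$; $L(\mathcal{B})$ is the set of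 $\omega$-words having a successful run. $\mathcal{M}$-$\mathcal{L}$-MSO: for a finite set $\Phi$ of $\mathcal{L}$-formulas with $n$ free variables, $\langle\alpha_1,\dots,\alpha_n\rangle$ is viewed as the structure $(\mathbb{N},0,<,S,(P_\phi)_{\phi\in\Phi})$ with usual $0,<$, successor $S$, and $P_\phi=\{i: \mathcal{M}\models\phi[\alpha_1(i),\dots,\alpha_n(i)]\}$; an $\mathcal{M}$-$\mathcal{L}$-MSO sentence $\psi$ is a monadic second-order sentence over such a signature, first-order variables ranging over $\mathbb{N}$ and second-order variables over sequences (subsets of $\mathbb{N}$). $L(\psi)$ is the set of $\langle\alpha_1,\dots,\alpha_n\rangle\in(M^n)^\omega$ whose associated structure satisfies $\psi$, and $R$ is $\mathcal{M}$-$\mathcal{L}$-MSO definable if $L_R=L(\psi)$ for some such $\psi$. -}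

module Defs where

open import Data.Nat using (ℕ; zero; suc; _≤_; _<_)
open import Data.Fin using (Fin)
open import Data.Bool using (Bool; true)
open import Data.List using (List)
open import Data.List.Membership.Propositional using (_∈_)
open import Data.Product using (Σ; ∃; _×_; _,_)
open import Data.Unit using (⊤)
open import Relation.Nullary using (¬_; Dec)
open import Relation.Binary.PropositionalEquality using (_≡_)
open import Function.Bundles using (_⇔_)

record Structure : Set₁ where
  field
    Dom   : Set
    Rel   : Set
    arity : Rel → ℕ
    holds : (r : Rel) → (Fin (arity r) → Dom) → Set

record Logic (𝓜 : Structure) : Set₁ where
  open Structure 𝓜
  field
    Form  : ℕ → Set
    _⊨_   : ∀ {n} → (Fin n → Dom) → Form n → Set
    ⊤′    : ∀ {n} → Form n
    ¬′_   : ∀ {n} → Form n → Form n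
    _∧′_  : ∀ {n} → Form n → Form n → Form n
    ⊨⊤′   : ∀ {n} (a : Fin n → Dom) → a ⊨ ⊤′
    ⊨¬′   : ∀ {n} (a : Fin n → Dom) (φ : Form n) → (a ⊨ (¬′ φ)) ⇔ (¬ (a ⊨ φ))
    ⊨∧′   : ∀ {n} (a : Fin n → Dom) (φ ψ : Form n) →
            (a ⊨ (φ ∧′ ψ)) ⇔ ((a ⊨ φ) × (a ⊨ ψ))

module _ (M : Set) where

  ω-Word : Set → Set
  ω-Word A = ℕ → A

  ωRel : ℕ → Set₁
  ωRel n = (Fin n → ω-Word M) → Set

conv : ∀ {M : Set} {n} → (Fin n → (ℕ → M)) → (ℕ → (Fin n → M))
conv α i j = α j i

module _ {𝓜 : Structure} (𝓛 : Logic 𝓜) where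
  open Structure 𝓜
  open Logic 𝓛

  record Büchi (n : ℕ) : Set where
    field
      nQ  : ℕ
      q₀  : Fin nQ
      Δ   : List (Fin nQ × Form n × Fin nQ)
      acc : Fin nQ → Bool

  module _ {n : ℕ} (B : Büchi n) where
    open Büchi B

    IsRun : (ℕ → (Fin n → Dom)) → (ℕ → Fin nQ) → Set
    IsRun w ρ = (ρ 0 ≡ q₀) ×
      (∀ i → Σ (Form n) λ φ → ((ρ i , φ , ρ (suc i)) ∈ Δ) × (w i ⊨ φ))

    Successful : (ℕ → Fin nQ) → Set
    Successful ρ = ∀ i → ∃ λ j → (i ≤ j) × (acc (ρ j) ≡ true)

    AcceptedBy : (ℕ → (Fin n → Dom)) → Set
    AcceptedBy w = Σ (ℕ → Fin nQ) λ ρ → IsRun w ρ × Successful ρ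

  -- 𝓜-𝓛-MSO: MSO over (ℕ, 0, <, S, (P_k)_{k<m}), de Bruijn style,
  -- with a first-order variables and b second-order variables.

  data Term (a : ℕ) : Set where
    var  : Fin a → Term a
    `0   : Term a
    `S   : Term a → Term a

  data MSO (m : ℕ) : ℕ → ℕ → Set where
    _≐_   : ∀ {a b} → Term a → Term a → MSO m a b
    _≺_   : ∀ {a b} → Term a → Term a → MSO m a b
    _∈̇_   : ∀ {a b} → Term a → Fin b → MSO m a b
    P     : ∀ {a b} → Fin m → Term a → MSO m a b
    ¬̇_    : ∀ {a b} → MSO m a b → MSO m a b
    _∧̇_   : ∀ {a b} → MSO m a b → MSO m a b → MSO m a b
    ∃¹    : ∀ {a b} → MSO m (suc a) b → MSO m a b
    ∃²    : ∀ {a b} → MSO m a (suc b) → MSO m a b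

  -- an 𝓜-𝓛-MSO sentence: a finite set Φ = {Φ 0,…,Φ (m-1)} of
  -- 𝓛-formulas with n free variables and an MSO sentence using P_Φk
  record MSOSentence (n : ℕ) : Set where
    field
      m   : ℕ
      Φ   : Fin m → Form n
      ψ   : MSO m 0 0

  ⟦_⟧ₜ : ∀ {a} → Term a → (Fin a → ℕ) → ℕ
  ⟦ var x ⟧ₜ σ = σ x
  ⟦ `0 ⟧ₜ σ = 0
  ⟦ `S t ⟧ₜ σ = suc (⟦ t ⟧ₜ σ)

  ext : ∀ {A : Set} {a} → A → (Fin a → A) → Fin (suc a) → A
  ext x σ Fin.zero = x
  ext x σ (Fin.suc i) = σ i

  Sat : ∀ {n m a b} → (ℕ → (Fin n → Dom)) → (Fin m → Form n) →
        MSO m a b → (Fin a → ℕ) → (Fin b → (ℕ → Bool)) → Set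
  Sat w Φ (s ≐ t) σ τ = ⟦ s ⟧ₜ σ ≡ ⟦ t ⟧ₜ σ
  Sat w Φ (s ≺ t) σ τ = ⟦ s ⟧ₜ σ < ⟦ t ⟧ₜ σ
  Sat w Φ (t ∈̇ X) σ τ = τ X (⟦ t ⟧ₜ σ) ≡ true
  Sat w Φ (P k t) σ τ = w (⟦ t ⟧ₜ σ) ⊨ Φ k
  Sat w Φ (¬̇ φ) σ τ = ¬ Sat w Φ φ σ τ
  Sat w Φ (φ ∧̇ χ) σ τ = Sat w Φ φ σ τ × Sat w Φ χ σ τ
  Sat w Φ (∃¹ φ) σ τ = Σ ℕ λ x → Sat w Φ φ (ext x σ) τ
  Sat w Φ (∃² φ) σ τ = Σ (ℕ → Bool) λ X → Sat w Φ φ σ (ext X τ)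

  Models : ∀ {n} → (ℕ → (Fin n → Dom)) → MSOSentence n → Set
  Models w S = Sat w Φ ψ (λ ()) (λ ())
    where open MSOSentence S

  -- Definability / recognizability of relations R ⊆ (M^ω)^n:
  -- L_R = L(ψ), resp. L_R = L(B).  Since every word over M^n is the
  -- convolution of a unique tuple, this is  R α ⇔ ⟨α⟩ ∈ L(…).

  MSODefinable : ∀ {n} → ωRel Dom n → Set
  MSODefinable {n} R = Σ (MSOSentence n) λ S →
    ∀ α → R α ⇔ Models (conv α) S

  BüchiRecognizable : ∀ {n} → ωRel Dom n → Set
  BüchiRecognizable {n} R = Σ (Büchi n) λ B →
    ∀ α → R α ⇔ AcceptedBy B (conv α)

ExcludedMiddle : Set₁
ExcludedMiddle = (P : Set) → Dec P

module Submission where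

-- MSO to automata goes through finite semigroups. First-order variables become singleton set
-- variables, so a sentence turns into a formula over set variables whose atoms are safety conditions.
-- Such a formula is recognised by a morphism h into a finite semigroup with a set of good pairs, in the
-- strong sense that whenever h ∘ u factorises as s t t t … with s·t = s and t·t = t, the pair (s, t)
-- decides whether u satisfies the formula. Ramsey's theorem provides such a factorisation for every
-- word, so complement is free, conjunction is the product semigroup and set quantification the
-- powerset semigroup. An automaton then guesses (s, t) and the cut points; since letters of M^n matter
-- only through which formulas of Φ they satisfy, its transitions are labelled by the formulas defining
-- these types. Conversely, a sentence accepts exactly when some partition of the positions into state
-- sets is an accepting run. Excluded middle decides the types and drives Ramsey's theorem.

open import Defs using (ExcludedMiddle)

module Finiteness where

  open import Data.Nat using (ℕ; zero; suc; _+_; _*_)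
  open import Data.Fin using (Fin)
  open import Data.Fin.Properties using (+↔⊎; *↔×; 1↔⊤; 2↔Bool; _≟_)
  open import Data.Bool using (Bool)
  open import Data.Maybe using (Maybe; just; nothing; maybe)
  open import Data.Unit using (⊤; tt)
  open import Data.Product using (_×_; _,_)
  open import Data.Product.Function.NonDependent.Propositional using (_×-↔_)
  open import Data.Sum using (_⊎_; inj₁; inj₂; [_,_])
  open import Data.Sum.Function.Propositional using (_⊎-↔_)
  open import Data.Vec using (Vec; []; _∷_; uncons)
  open import Data.List using (List; map; allFin)
  open import Data.List.Membership.Propositional using (_∈_)
  open import Data.List.Membership.Propositional.Properties using (∈-map⁺; ∈-allFin)
  open import Function using (const)
  open import Function.Bundles using (_↔_; Inverse; mk↔ₛ′)
  open import Function.Properties.Inverse using (↔-sym; ↔-trans)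
  open import Relation.Binary.PropositionalEquality using (_≡_; refl; sym; trans; cong; subst)
  open import Relation.Nullary using (Dec; yes; no)

  record Finite (A : Set) : Set where
    field
      size      : ℕ
      bijection : A ↔ Fin size
  open Finite public using (size)

  module _ {A : Set} (F : Finite A) where
    open Finite F using (bijection)

    indexOf : A → Fin (size F)
    indexOf = Inverse.to bijection

    elementAt : Fin (size F) → A
    elementAt = Inverse.from bijection

    elementAt-indexOf : ∀ x → elementAt (indexOf x) ≡ x
    elementAt-indexOf = Inverse.strictlyInverseʳ bijection

    indexOf-elementAt : ∀ i → indexOf (elementAt i) ≡ i
    indexOf-elementAt = Inverse.strictlyInverseˡ bijection

    enumerate : List A
    enumerate = map elementAt (allFin (size F))

    ∈-enumerate : ∀ x → x ∈ enumerate
    ∈-enumerate x = subst (_∈ enumerate) (elementAt-indexOf x) (∈-map⁺ elementAt (∈-allFin (indexOf x)))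

    decEq : (x y : A) → Dec (x ≡ y)
    decEq x y with indexOf x ≟ indexOf y
    ... | yes p = yes (trans (sym (elementAt-indexOf x)) (trans (cong elementAt p) (elementAt-indexOf y)))
    ... | no ¬p = no λ q → ¬p (cong indexOf q)

  finite-↔ : ∀ {A B} → Finite A → A ↔ B → Finite B
  finite-↔ F A↔B = record { size = size F ; bijection = ↔-trans (↔-sym A↔B) (Finite.bijection F) }

  ⊤-finite : Finite ⊤
  ⊤-finite = record { size = 1 ; bijection = ↔-sym 1↔⊤ }

  Bool-finite : Finite Bool
  Bool-finite = record { size = 2 ; bijection = ↔-sym 2↔Bool }

  ×-finite : ∀ {A B} → Finite A → Finite B → Finite (A × B)
  ×-finite FA FB = record
    { size = size FA * size FB ; bijection = ↔-trans (Finite.bijection FA ×-↔ Finite.bijection FB) (↔-sym *↔×) }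

  ⊎-finite : ∀ {A B} → Finite A → Finite B → Finite (A ⊎ B)
  ⊎-finite FA FB = record
    { size = size FA + size FB ; bijection = ↔-trans (Finite.bijection FA ⊎-↔ Finite.bijection FB) (↔-sym +↔⊎) }

  Maybe-finite : ∀ {A} → Finite A → Finite (Maybe A)
  Maybe-finite FA = finite-↔ (⊎-finite ⊤-finite FA)
    (mk↔ₛ′ [ const nothing , just ] (maybe inj₂ (inj₁ tt)) (maybe (λ _ → refl) refl) [ (λ _ → refl) , (λ _ → refl) ])

  Vec-finite : ∀ {A} → Finite A → ∀ n → Finite (Vec A n)
  Vec-finite FA zero = finite-↔ ⊤-finite (mk↔ₛ′ (λ _ → []) (λ _ → tt) (λ { [] → refl }) (λ _ → refl))
  Vec-finite FA (suc n) = finite-↔ (×-finite FA (Vec-finite FA n))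
    (mk↔ₛ′ (λ (a , v) → a ∷ v) uncons (λ { (a ∷ v) → refl }) (λ _ → refl))


module Classical (em : ExcludedMiddle) where

  open import Data.Empty using (⊥-elim)
  open import Relation.Nullary using (¬_; yes; no)

  ¬¬-elim : ∀ {P : Set} → ¬ ¬ P → P
  ¬¬-elim {P} ¬¬p with em P
  ... | yes p = p
  ... | no ¬p = ⊥-elim (¬¬p ¬p)


module BoolEquations where

  open import Data.Bool using (Bool; true; false; not; _∧_; _∨_)
  open import Data.Bool.ListAction using (any)
  open import Data.List using (_∷_)
  open import Data.List.Membership.Propositional using (_∈_)
  open import Data.List.Relation.Unary.Any using (here; there)
  open import Data.Product using (Σ; _×_; _,_)
  open import Data.Sum using (_⊎_; inj₁; inj₂)
  open import Data.Empty using (⊥-elim)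
  open import Function.Bundles using (_⇔_; mk⇔; Equivalence)
  open import Relation.Binary.PropositionalEquality using (_≡_; refl; sym)
  open import Relation.Nullary using (¬_; Dec; yes; no)
  open import Relation.Nullary.Decidable using (isYes)
  open Equivalence

  isYes≡true⇔ : ∀ {P : Set} (d : Dec P) → (isYes d ≡ true) ⇔ P
  isYes≡true⇔ (yes p) = mk⇔ (λ _ → p) (λ _ → refl)
  isYes≡true⇔ (no ¬p) = mk⇔ (λ ()) (λ p → ⊥-elim (¬p p))

  not≡true⇔ : ∀ a → (not a ≡ true) ⇔ (a ≡ false)
  not≡true⇔ true = mk⇔ (λ ()) (λ ())
  not≡true⇔ false = mk⇔ (λ _ → refl) (λ _ → refl)

  ¬≡true⇔not≡true : ∀ b → (¬ (b ≡ true)) ⇔ (not b ≡ true)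
  ¬≡true⇔not≡true true = mk⇔ (λ f → ⊥-elim (f refl)) (λ ())
  ¬≡true⇔not≡true false = mk⇔ (λ _ → refl) (λ _ ())

  ∧≡true⇔ : ∀ a b → (a ∧ b ≡ true) ⇔ ((a ≡ true) × (b ≡ true))
  ∧≡true⇔ true true = mk⇔ (λ _ → refl , refl) (λ _ → refl)
  ∧≡true⇔ true false = mk⇔ (λ ()) (λ ())
  ∧≡true⇔ false b = mk⇔ (λ ()) (λ ())

  ∨≡true⇔ : ∀ a b → (a ∨ b ≡ true) ⇔ ((a ≡ true) ⊎ (b ≡ true))
  ∨≡true⇔ true b = mk⇔ (λ _ → inj₁ refl) (λ _ → refl)
  ∨≡true⇔ false b = mk⇔ inj₂ (λ { (inj₁ ()) ; (inj₂ p) → p })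

  ⇒ᵇ≡true⇔ : ∀ a b → (not (a ∧ not b) ≡ true) ⇔ (a ≡ true → b ≡ true)
  ⇒ᵇ≡true⇔ true true = mk⇔ (λ _ _ → refl) (λ _ → refl)
  ⇒ᵇ≡true⇔ true false = mk⇔ (λ ()) (λ f → f refl)
  ⇒ᵇ≡true⇔ false b = mk⇔ (λ _ ()) (λ _ → refl)

  iffᵇ : Bool → Bool → Bool
  iffᵇ true b = b
  iffᵇ false b = not b

  iffᵇ≡true⇔ : ∀ a b → (iffᵇ a b ≡ true) ⇔ (a ≡ b)
  iffᵇ≡true⇔ true true = mk⇔ (λ _ → refl) (λ _ → refl)
  iffᵇ≡true⇔ true false = mk⇔ (λ ()) (λ ())
  iffᵇ≡true⇔ false true = mk⇔ (λ ()) (λ ())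
  iffᵇ≡true⇔ false false = mk⇔ (λ _ → refl) (λ _ → refl)

  false≢true : ¬ (false ≡ true)
  false≢true ()

  ≡true-ext : ∀ {b c : Bool} → (b ≡ true → c ≡ true) → (c ≡ true → b ≡ true) → b ≡ c
  ≡true-ext {true} {true} f g = refl
  ≡true-ext {true} {false} f g = sym (f refl)
  ≡true-ext {false} {true} f g = g refl
  ≡true-ext {false} {false} f g = refl

  any-intro : ∀ {X : Set} (p : X → Bool) {xs x} → x ∈ xs → p x ≡ true → any p xs ≡ true
  any-intro p {y ∷ xs} (here refl) px = from (∨≡true⇔ (p y) _) (inj₁ px)
  any-intro p {y ∷ xs} (there x∈xs) px = from (∨≡true⇔ (p y) _) (inj₂ (any-intro p x∈xs px))

  any-elim : ∀ {X : Set} (p : X → Bool) xs → any p xs ≡ true → Σ X λ x → p x ≡ true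
  any-elim p (y ∷ xs) e with to (∨≡true⇔ (p y) _) e
  ... | inj₁ py = y , py
  ... | inj₂ rest = any-elim p xs rest


module InfiniteRamsey where

  open import Data.Nat using (ℕ; zero; suc; _+_; _∸_; _≤_; _<_; s≤s)
  open import Data.Nat.Properties
  open import Data.Empty using (⊥-elim)
  open import Data.Unit using (⊤; tt)
  open import Data.Sum using (inj₁; inj₂)
  open import Data.Product using (Σ; _×_; _,_; proj₁; proj₂)
  open import Data.List using (List; []; _∷_)
  open import Data.List.Membership.Propositional using (_∈_)
  open import Data.List.Relation.Unary.Any using (here; there)
  open import Data.Bool using (Bool; true; false)
  open import Relation.Binary.PropositionalEquality using (_≡_; refl; sym; trans; cong; subst)
  open import Function using (_∘_)
  open import Relation.Nullary using (¬_; yes; no)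
  open Finiteness

  InfinitelyOften : (ℕ → Set) → Set
  InfinitelyOften P = ∀ i → Σ ℕ λ j → i ≤ j × P j

  Increasing : (ℕ → ℕ) → Set
  Increasing g = ∀ i → g i < g (suc i)

  increasing⇒strictMono : ∀ g → Increasing g → ∀ {i j} → i < j → g i < g j
  increasing⇒strictMono g inc {i} {suc j} (s≤s i≤j) with m≤n⇒m<n∨m≡n i≤j
  ... | inj₁ i<j = <-trans (increasing⇒strictMono g inc i<j) (inc j)
  ... | inj₂ refl = inc i

  scan : (ℕ → Bool) → ℕ → ℕ → ℕ
  scan f i zero = i
  scan f i (suc n) with f i
  ... | true = i
  ... | false = scan f (suc i) n

  scan-first : ∀ f i n → f (i + n) ≡ true → (i ≤ scan f i n) × (f (scan f i n) ≡ true) × (∀ j → i ≤ j → j < scan f i n → f j ≡ false)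
  scan-first f i zero e rewrite +-identityʳ i = ≤-refl , e , λ j ij jl → ⊥-elim (<-irrefl refl (≤-trans jl ij))
  scan-first f i (suc n) e with f i in fi
  ... | true = ≤-refl , fi , λ j ij jl → ⊥-elim (<-irrefl refl (≤-trans jl ij))
  ... | false with scan-first f (suc i) n (trans (cong f (sym (+-suc i n))) e)
  ... | si≤ , found , none-before = ≤-trans (n≤1+n i) si≤ , found , λ j ij jl → none-from-i j ij jl
    where
    none-from-i : ∀ j → i ≤ j → j < scan f (suc i) n → f j ≡ false
    none-from-i j ij jl with m≤n⇒m<n∨m≡n ij
    ... | inj₁ i<j = none-before j i<j jl
    ... | inj₂ refl = fi

  module NextTrue (f : ℕ → Bool) (inf : InfinitelyOften (λ j → f j ≡ true)) where
    nextTrue : ℕ → ℕ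
    nextTrue i = scan f i (proj₁ (inf i) ∸ i)

    nextTrue-first : ∀ i → (i ≤ nextTrue i) × (f (nextTrue i) ≡ true) × (∀ j → i ≤ j → j < nextTrue i → f j ≡ false)
    nextTrue-first i = scan-first f i (proj₁ (inf i) ∸ i) (trans (cong f (m+[n∸m]≡n (proj₁ (proj₂ (inf i))))) (proj₂ (proj₂ (inf i))))

  module _ (em : ExcludedMiddle) where
    open Classical em

    ¬infinitelyOften⇒eventually¬ : ∀ {P} → ¬ InfinitelyOften P → Σ ℕ λ N → ∀ j → N ≤ j → ¬ P j
    ¬infinitelyOften⇒eventually¬ ¬inf =
      ¬¬-elim λ ¬ev → ¬inf λ i → ¬¬-elim λ ¬later → ¬ev (i , λ j i≤j pj → ¬later (j , i≤j , pj))

    pigeonhole-list : ∀ {C : Set} (f : ℕ → C) (L : List C) (P : ℕ → Set) →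
                      (∀ j → P j → f j ∈ L) → InfinitelyOften P →
                      Σ C λ c → InfinitelyOften (λ j → P j × f j ≡ c)
    pigeonhole-list f [] P mem inf with mem _ (proj₂ (proj₂ (inf 0)))
    ... | ()
    pigeonhole-list f (c ∷ L) P mem inf with em (InfinitelyOften (λ j → P j × f j ≡ c))
    ... | yes inf-c = c , inf-c
    ... | no ¬inf-c with ¬infinitelyOften⇒eventually¬ ¬inf-c
    ... | N , avoid with pigeonhole-list f L (λ j → P j × N ≤ j) mem-L inf-N
      where
      mem-L : ∀ j → P j × N ≤ j → f j ∈ L
      mem-L j (pj , N≤j) with mem j pj
      ... | here fj≡c = ⊥-elim (avoid j N≤j (pj , fj≡c))
      ... | there fj∈L = fj∈L
      inf-N : InfinitelyOften (λ j → P j × N ≤ j)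
      inf-N i with inf (i + N)
      ... | j , i+N≤j , pj = j , ≤-trans (m≤m+n i N) i+N≤j , pj , ≤-trans (m≤n+m N i) i+N≤j
    ... | c′ , inf-c′ = c′ , λ i → let (j , i≤j , (pj , _) , fj≡c′) = inf-c′ i in j , i≤j , pj , fj≡c′

    pigeonhole : ∀ {C : Set} → Finite C → (f : ℕ → C) (P : ℕ → Set) → InfinitelyOften P →
                 Σ C λ c → InfinitelyOften (λ j → P j × f j ≡ c)
    pigeonhole F f P inf = pigeonhole-list f (enumerate F) P (λ j _ → ∈-enumerate F (f j)) inf

    -- Stage n is an infinite set whose elements beyond x n all receive the colour c n from x n,
    -- where x n is its least witness; pigeonhole on the colours c n then finishes.
    module RamseyConstruction {C : Set} (F : Finite C) (col : ℕ → ℕ → C) where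

      record Stage : Set₁ where
        field
          P   : ℕ → Set
          inf : InfinitelyOften P

      head : Stage → ℕ
      head S = proj₁ (Stage.inf S 0)

      colourFromHead : (S : Stage) →
        Σ C λ c → InfinitelyOften (λ j → (Stage.P S j × head S < j) × col (head S) j ≡ c)
      colourFromHead S = pigeonhole F (col (head S)) _ λ i →
        let (j , ij , pj) = Stage.inf S (suc (i + head S)) in
        j , ≤-trans (≤-trans (m≤m+n i (head S)) (n≤1+n _)) ij , pj , ≤-trans (s≤s (m≤n+m (head S) i)) ij

      next : Stage → Stage
      next S = record { P = λ j → (Stage.P S j × head S < j) × col (head S) j ≡ proj₁ (colourFromHead S)
                      ; inf = proj₂ (colourFromHead S) }

      stage : ℕ → Stage
      stage zero = record { P = λ _ → ⊤ ; inf = λ i → i , ≤-refl , tt }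
      stage (suc n) = next (stage n)

      x : ℕ → ℕ
      x n = head (stage n)

      c : ℕ → C
      c n = proj₁ (colourFromHead (stage n))

      x∈stage : ∀ n → Stage.P (stage n) (x n)
      x∈stage n = proj₂ (proj₂ (Stage.inf (stage n) 0))

      stage-antitone : ∀ n d j → Stage.P (stage (suc n + d)) j → Stage.P (stage (suc n)) j
      stage-antitone n zero j p rewrite +-identityʳ n = p
      stage-antitone n (suc d) j p rewrite +-suc n d = stage-antitone n d j (proj₁ (proj₁ p))

      x-colour : ∀ {n m} → n < m → (x n < x m) × col (x n) (x m) ≡ c n
      x-colour {n} {m} n<m = subst (λ m → (x n < x m) × col (x n) (x m) ≡ c n) (m+[n∸m]≡n n<m)
        (let p = stage-antitone n (m ∸ suc n) _ (x∈stage (suc n + (m ∸ suc n))) in proj₂ (proj₁ p) , proj₂ p)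

      constantColour : Σ C λ t → InfinitelyOften (λ j → ⊤ × c j ≡ t)
      constantColour = pigeonhole F c (λ _ → ⊤) (λ i → i , ≤-refl , tt)

      t : C
      t = proj₁ constantColour

      g : ℕ → ℕ
      g zero = proj₁ (proj₂ constantColour 0)
      g (suc i) = proj₁ (proj₂ constantColour (suc (g i)))

      g-increasing : Increasing g
      g-increasing i = proj₁ (proj₂ (proj₂ constantColour (suc (g i))))

      c∘g≡t : ∀ i → c (g i) ≡ t
      c∘g≡t zero = proj₂ (proj₂ (proj₂ (proj₂ constantColour 0)))
      c∘g≡t (suc i) = proj₂ (proj₂ (proj₂ (proj₂ constantColour (suc (g i)))))

    ramsey : ∀ {C : Set} → Finite C → (col : ℕ → ℕ → C) →
             Σ C λ t → Σ (ℕ → ℕ) λ k → Increasing k × (∀ {i j} → i < j → col (k i) (k j) ≡ t)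
    ramsey F col = t , x ∘ g , (λ i → proj₁ (x-colour (g-increasing i)))
                 , λ {i} i<j → trans (proj₂ (x-colour (increasing⇒strictMono g g-increasing i<j))) (c∘g≡t i)
      where
      open RamseyConstruction F col


module LinkedFactorisation where

  open import Data.Nat using (ℕ; zero; suc; _+_; _∸_; _≤_; _<_; z≤n; s≤s)
  open import Data.Nat.Properties
  open import Data.Bool using (Bool; true; _∧_)
  open import Data.Maybe using (Maybe; just; nothing)
  open import Data.Maybe.Properties using (just-injective)
  open import Data.Product using (Σ; _×_; _,_; proj₁; proj₂)
  open import Function using (_∘_)
  open import Function.Bundles using (_⇔_; mk⇔; Equivalence)
  open import Relation.Binary.PropositionalEquality
  open import Relation.Nullary.Decidable using (isYes)
  open Finiteness
  open BoolEquations
  open InfiniteRamsey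
  open Equivalence

  record FiniteSemigroup : Set₁ where
    field
      T     : Set
      fin   : Finite T
      _·_   : T → T → T
      assoc : ∀ x y z → (x · y) · z ≡ x · (y · z)

  cut : ℕ → (ℕ → ℕ) → ℕ → ℕ
  cut c0 d zero = c0
  cut c0 d (suc k) = cut c0 d k + d k

  module Factorisation (S : FiniteSemigroup) where
    open FiniteSemigroup S public

    infixl 6 _⊕_
    _⊕_ : Maybe T → Maybe T → Maybe T
    nothing ⊕ y = y
    just x ⊕ nothing = just x
    just x ⊕ just y = just (x · y)

    ⊕-identityʳ : ∀ x → x ⊕ nothing ≡ x
    ⊕-identityʳ nothing = refl
    ⊕-identityʳ (just x) = refl

    ⊕-assoc : ∀ x y z → (x ⊕ y) ⊕ z ≡ x ⊕ (y ⊕ z)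
    ⊕-assoc nothing y z = refl
    ⊕-assoc (just x) nothing z = refl
    ⊕-assoc (just x) (just y) nothing = refl
    ⊕-assoc (just x) (just y) (just z) = cong just (assoc x y z)

    -- val hu i l is the product hu i · … · hu (i + l ∸ 1); the empty product is nothing.
    val : (ℕ → T) → ℕ → ℕ → Maybe T
    val hu i zero = nothing
    val hu i (suc l) = val hu i l ⊕ just (hu (i + l))

    val-+ : ∀ hu i l₁ l₂ → val hu i (l₁ + l₂) ≡ val hu i l₁ ⊕ val hu (i + l₁) l₂
    val-+ hu i l₁ zero rewrite +-identityʳ l₁ = sym (⊕-identityʳ _)
    val-+ hu i l₁ (suc l₂) rewrite +-suc l₁ l₂ | val-+ hu i l₁ l₂ | +-assoc i l₁ l₂ =
      ⊕-assoc (val hu i l₁) (val hu (i + l₁) l₂) _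

    val-∸ : ∀ hu {a b c} → a ≤ b → b ≤ c → val hu a (c ∸ a) ≡ val hu a (b ∸ a) ⊕ val hu b (c ∸ b)
    val-∸ hu {a} {b} {c} a≤b b≤c = begin
      val hu a (c ∸ a)                          ≡⟨ cong (val hu a) (sym ∸-chain) ⟩
      val hu a ((b ∸ a) + (c ∸ b))              ≡⟨ val-+ hu a (b ∸ a) (c ∸ b) ⟩
      val hu a (b ∸ a) ⊕ val hu (a + (b ∸ a)) (c ∸ b) ≡⟨ cong (λ z → val hu a (b ∸ a) ⊕ val hu z (c ∸ b)) (m+[n∸m]≡n a≤b) ⟩
      val hu a (b ∸ a) ⊕ val hu b (c ∸ b)       ∎
      where
      open ≡-Reasoning
      ∸-chain : (b ∸ a) + (c ∸ b) ≡ c ∸ a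
      ∸-chain = trans (sym (+-∸-comm (c ∸ b) a≤b)) (cong (_∸ a) (trans (+-comm b (c ∸ b)) (m∸n+n≡m b≤c)))

    val-suc-just : ∀ hu i l → Σ T λ x → val hu i (suc l) ≡ just x
    val-suc-just hu i zero = _ , refl
    val-suc-just hu i (suc l) with val-suc-just hu i l
    ... | x , e rewrite e = _ , refl

    -- segment hu j l is the value of the nonempty factor hu j · … · hu (j + l).
    segment : (ℕ → T) → ℕ → ℕ → T
    segment hu j l = proj₁ (val-suc-just hu j l)

    val≡segment : ∀ hu j l → val hu j (suc l) ≡ just (segment hu j l)
    val≡segment hu j l = proj₂ (val-suc-just hu j l)

    segment-zero : ∀ hu j → segment hu j 0 ≡ hu (j + 0)
    segment-zero hu j = just-injective (sym (val≡segment hu j 0))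

    segment-suc : ∀ hu j l → segment hu j (suc l) ≡ segment hu j l · hu (j + suc l)
    segment-suc hu j l = just-injective (trans (sym (val≡segment hu j (suc l))) (cong (_⊕ just (hu (j + suc l))) (val≡segment hu j l)))

    val<-just : ∀ hu {a b} → a < b → Σ T λ x → val hu a (b ∸ a) ≡ just x
    val<-just hu {a} {b} a<b =
      subst (λ z → Σ T λ x → val hu a z ≡ just x) (sym (+-∸-assoc 1 a<b)) (val-suc-just hu a (b ∸ suc a))

    val-local : ∀ {hu hu′} i l → (∀ r → r < l → hu (i + r) ≡ hu′ (i + r)) → val hu i l ≡ val hu′ i l
    val-local i zero e = refl
    val-local i (suc l) e = cong₂ _⊕_ (val-local i l (λ r r<l → e r (m<n⇒m<1+n r<l))) (cong just (e l (n<1+n l)))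

    val-just⇒positive : ∀ {hu i l x} → val hu i l ≡ just x → 0 < l
    val-just⇒positive {l = suc l} _ = s≤s z≤n

    Linked : T → T → Set
    Linked s t = (s · t ≡ s) × (t · t ≡ t)

    linked? : T → T → Bool
    linked? s t = isYes (decEq fin (s · t) s) ∧ isYes (decEq fin (t · t) t)

    linked?≡true⇔ : ∀ s t → (linked? s t ≡ true) ⇔ Linked s t
    linked?≡true⇔ s t = mk⇔
      (λ e → let (a , b) = to (∧≡true⇔ _ _) e in to (isYes≡true⇔ (decEq fin _ _)) a , to (isYes≡true⇔ (decEq fin _ _)) b)
      (λ (a , b) → from (∧≡true⇔ _ _) (from (isYes≡true⇔ (decEq fin _ _)) a , from (isYes≡true⇔ (decEq fin _ _)) b))

    -- hu cut at c0, c0 + d 0, c0 + d 0 + d 1, … into a prefix of value s and blocks of value t.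
    record Factorises (hu : ℕ → T) (s t : T) : Set where
      field
        c0  : ℕ
        d   : ℕ → ℕ
        pre : val hu 0 c0 ≡ just s
        blk : ∀ k → val hu (cut c0 d k) (d k) ≡ just t

    factorises-fromCuts : ∀ hu (k : ℕ → ℕ) (t : T) → Increasing k →
                          (∀ i → val hu (k i) (k (suc i) ∸ k i) ≡ just t) →
                          ∀ s → val hu 0 (k 0) ≡ just s → Factorises hu s t
    factorises-fromCuts hu k t inc blk s pre =
      record { c0 = k 0 ; d = λ i → k (suc i) ∸ k i ; pre = pre ; blk = λ i → subst (λ z → val hu z (k (suc i) ∸ k i) ≡ just t) (sym (cut≡k i)) (blk i) }
      where
      cut≡k : ∀ i → cut (k 0) (λ i → k (suc i) ∸ k i) i ≡ k i
      cut≡k zero = refl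
      cut≡k (suc i) rewrite cut≡k i = m+[n∸m]≡n (<⇒≤ (inc i))

    LinkedFactorisationAlong : (ℕ → T) → (ℕ → ℕ) → Set
    LinkedFactorisationAlong hu q = Σ T λ s → Σ T λ t → Σ (ℕ → ℕ) λ k → Increasing k × Linked s t ×
      (val hu 0 (q (k 0)) ≡ just s) × (∀ i → val hu (q (k i)) (q (k (suc i)) ∸ q (k i)) ≡ just t)

    homogeneous⇒linked : ∀ hu (p : ℕ → ℕ) → Increasing p → ∀ t′ →
      (∀ {i j} → i < j → val hu (p i) (p j ∸ p i) ≡ t′) →
      Σ T λ s → Σ T λ t → Linked s t × (val hu 0 (p 1) ≡ just s) × t′ ≡ just t
    homogeneous⇒linked hu p inc t′ hom = s , t , (s·t≡s , t·t≡t) , val₀₁≡s , t′≡t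
      where
      0<1 : 0 < 1
      0<1 = s≤s z≤n
      1<2 : 1 < 2
      1<2 = s≤s 0<1
      p≤ : ∀ {i j} → i < j → p i ≤ p j
      p≤ i<j = <⇒≤ (increasing⇒strictMono p inc i<j)
      t = proj₁ (val<-just hu (inc 0))
      t′≡t : t′ ≡ just t
      t′≡t = trans (sym (hom 0<1)) (proj₂ (val<-just hu (inc 0)))
      block : ∀ {i j} → i < j → val hu (p i) (p j ∸ p i) ≡ just t
      block i<j = trans (hom i<j) t′≡t
      t·t≡t : t · t ≡ t
      t·t≡t = just-injective (begin
        just t ⊕ just t                               ≡⟨ cong₂ _⊕_ (block 0<1) (block 1<2) ⟨
        val hu (p 0) (p 1 ∸ p 0) ⊕ val hu (p 1) (p 2 ∸ p 1) ≡⟨ val-∸ hu (p≤ 0<1) (p≤ 1<2) ⟨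
        val hu (p 0) (p 2 ∸ p 0)                      ≡⟨ block (s≤s z≤n) ⟩
        just t                                        ∎)
        where open ≡-Reasoning
      prefix : Maybe T
      prefix = val hu 0 (p 0)
      val₀≡ : ∀ {j} → 0 < j → val hu 0 (p j) ≡ prefix ⊕ just t
      val₀≡ 0<j = trans (val-∸ hu z≤n (p≤ 0<j)) (cong (prefix ⊕_) (block 0<j))
      s-just : Σ T λ s → prefix ⊕ just t ≡ just s
      s-just with prefix
      ... | nothing = t , refl
      ... | just a = a · t , refl
      s = proj₁ s-just
      val₀₁≡s : val hu 0 (p 1) ≡ just s
      val₀₁≡s = trans (val₀≡ 0<1) (proj₂ s-just)
      s·t≡s : s · t ≡ s
      s·t≡s = just-injective (begin
        just s ⊕ just t                               ≡⟨ cong₂ _⊕_ val₀₁≡s (block 1<2) ⟨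
        val hu 0 (p 1) ⊕ val hu (p 1) (p 2 ∸ p 1)     ≡⟨ val-∸ hu z≤n (p≤ 1<2) ⟨
        val hu 0 (p 2)                                ≡⟨ trans (val₀≡ (s≤s z≤n)) (proj₂ s-just) ⟩
        just s                                        ∎)
        where open ≡-Reasoning

    module _ (em : ExcludedMiddle) where

      factorise-along : ∀ hu (q : ℕ → ℕ) → Increasing q → LinkedFactorisationAlong hu q
      factorise-along hu q q-inc = fromHomogeneous (ramsey em (Maybe-finite fin) λ i j → val hu (q i) (q j ∸ q i))
        where
        fromHomogeneous : (Σ (Maybe T) λ t′ → Σ (ℕ → ℕ) λ k → Increasing k ×
                            (∀ {i j} → i < j → val hu (q (k i)) (q (k j) ∸ q (k i)) ≡ t′)) →
                          LinkedFactorisationAlong hu q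
        fromHomogeneous (t′ , k , k-inc , hom) with homogeneous⇒linked hu (λ i → q (k i)) (λ i → increasing⇒strictMono q q-inc (k-inc i)) t′ hom
        ... | s , t , linked , pre , t′≡t = s , t , (λ i → k (suc i)) , (λ i → k-inc (suc i)) , linked , pre , λ i → trans (hom (n<1+n (suc i))) t′≡t

      factorise : ∀ hu → Σ T λ s → Σ T λ t → Linked s t × Factorises hu s t
      factorise hu = fromCuts (factorise-along hu (λ i → i) n<1+n)
        where
        fromCuts : LinkedFactorisationAlong hu (λ i → i) → Σ T λ s → Σ T λ t → Linked s t × Factorises hu s t
        fromCuts (s , t , k , k-inc , linked , pre , blk) = s , t , linked , factorises-fromCuts hu k t k-inc blk s pre

  record Recognizer (A : Set) : Set₁ where
    field
      sg   : FiniteSemigroup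
      h    : A → FiniteSemigroup.T sg
      good : FiniteSemigroup.T sg → FiniteSemigroup.T sg → Bool

  Recognizes : ∀ {A} → Recognizer A → ((ℕ → A) → Set) → Set
  Recognizes {A} R L = ∀ (u : ℕ → A) s t → Linked s t → Factorises (h ∘ u) s t → L u ⇔ (good s t ≡ true)
    where open Recognizer R
          open Factorisation sg


module BooleanClosure where

  open import Data.Nat using (zero; suc)
  open import Data.Bool using (not; _∧_)
  open import Data.Maybe using (Maybe; just; nothing)
  open import Data.Product using (_×_; _,_; proj₁; proj₂)
  open import Function using (_∘_)
  open import Function.Bundles using (mk⇔; Equivalence)
  open import Relation.Binary.PropositionalEquality using (_≡_; refl; sym; trans; cong; cong₂)
  open import Relation.Nullary using (¬_)
  open Finiteness
  open BoolEquations
  open LinkedFactorisation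
  open Equivalence

  complementR : ∀ {A} → Recognizer A → Recognizer A
  complementR R = record { sg = Recognizer.sg R ; h = Recognizer.h R ; good = λ s t → not (Recognizer.good R s t) }

  -- Complementation is free because a recognizer decides membership for every linked factorisation.
  complementR-recognizes : ∀ {A} (R : Recognizer A) L → Recognizes R L → Recognizes (complementR R) (λ u → ¬ L u)
  complementR-recognizes R L R-L u s t linked f = mk⇔
    (λ ¬l → to (¬≡true⇔not≡true _) (λ g → ¬l (from (R-L u s t linked f) g)))
    (λ ng l → from (¬≡true⇔not≡true _) ng (to (R-L u s t linked f) l))

  comapR : ∀ {A B} → (B → A) → Recognizer A → Recognizer B
  comapR g R = record { sg = Recognizer.sg R ; h = Recognizer.h R ∘ g ; good = Recognizer.good R }

  comapR-recognizes : ∀ {A B} (g : B → A) (R : Recognizer A) L → Recognizes R L → Recognizes (comapR g R) (λ u → L (g ∘ u))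
  comapR-recognizes g R L R-L u = R-L (g ∘ u)

  ×-semigroup : FiniteSemigroup → FiniteSemigroup → FiniteSemigroup
  ×-semigroup S₁ S₂ = record
    { T = FiniteSemigroup.T S₁ × FiniteSemigroup.T S₂
    ; fin = ×-finite (FiniteSemigroup.fin S₁) (FiniteSemigroup.fin S₂)
    ; _·_ = λ (a , b) (c , d) → FiniteSemigroup._·_ S₁ a c , FiniteSemigroup._·_ S₂ b d
    ; assoc = λ (a , b) (c , d) (e , f) → cong₂ _,_ (FiniteSemigroup.assoc S₁ a c e) (FiniteSemigroup.assoc S₂ b d f) }

  zipMaybe : ∀ {A B : Set} → Maybe A → Maybe B → Maybe (A × B)
  zipMaybe (just a) (just b) = just (a , b)
  zipMaybe _ _ = nothing

  zipMaybe≡just : ∀ {A B : Set} (x : Maybe A) (y : Maybe B) {a b} → zipMaybe x y ≡ just (a , b) → (x ≡ just a) × (y ≡ just b)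
  zipMaybe≡just (just a) (just b) refl = refl , refl

  module _ (S₁ S₂ : FiniteSemigroup) where
    private
      module F₁ = Factorisation S₁
      module F₂ = Factorisation S₂
      module F = Factorisation (×-semigroup S₁ S₂)

    val-× : ∀ hu₁ hu₂ i l → F.val (λ j → hu₁ j , hu₂ j) i l ≡ zipMaybe (F₁.val hu₁ i l) (F₂.val hu₂ i l)
    val-× hu₁ hu₂ i zero = refl
    val-× hu₁ hu₂ i (suc zero) = refl
    val-× hu₁ hu₂ i (suc (suc l)) rewrite val-× hu₁ hu₂ i (suc l)
      | proj₂ (F₁.val-suc-just hu₁ i l) | proj₂ (F₂.val-suc-just hu₂ i l) = refl

    factorises-proj : ∀ hu₁ hu₂ {s₁ s₂ t₁ t₂} → F.Factorises (λ j → hu₁ j , hu₂ j) (s₁ , s₂) (t₁ , t₂) →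
                      F₁.Factorises hu₁ s₁ t₁ × F₂.Factorises hu₂ s₂ t₂
    factorises-proj hu₁ hu₂ f =
      record { c0 = c0 ; d = d ; pre = proj₁ pre′ ; blk = λ k → proj₁ (blk′ k) } ,
      record { c0 = c0 ; d = d ; pre = proj₂ pre′ ; blk = λ k → proj₂ (blk′ k) }
      where
      open F.Factorises f
      pre′ = zipMaybe≡just _ _ (trans (sym (val-× hu₁ hu₂ 0 c0)) pre)
      blk′ = λ k → zipMaybe≡just _ _ (trans (sym (val-× hu₁ hu₂ (cut c0 d k) (d k))) (blk k))

  intersectionR : ∀ {A} → Recognizer A → Recognizer A → Recognizer A
  intersectionR R₁ R₂ = record
    { sg = ×-semigroup (Recognizer.sg R₁) (Recognizer.sg R₂)
    ; h = λ a → Recognizer.h R₁ a , Recognizer.h R₂ a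
    ; good = λ (s₁ , s₂) (t₁ , t₂) → Recognizer.good R₁ s₁ t₁ ∧ Recognizer.good R₂ s₂ t₂ }

  intersectionR-recognizes : ∀ {A} (R₁ R₂ : Recognizer A) L₁ L₂ → Recognizes R₁ L₁ → Recognizes R₂ L₂ →
                             Recognizes (intersectionR R₁ R₂) (λ u → L₁ u × L₂ u)
  intersectionR-recognizes R₁ R₂ L₁ L₂ R₁-L₁ R₂-L₂ u (s₁ , s₂) (t₁ , t₂) (st≡s , tt≡t) f
    with factorises-proj (Recognizer.sg R₁) (Recognizer.sg R₂) _ _ f
  ... | f₁ , f₂ = mk⇔
    (λ (l₁ , l₂) → from (∧≡true⇔ _ _) (to (R₁-L₁ u s₁ t₁ linked₁ f₁) l₁ , to (R₂-L₂ u s₂ t₂ linked₂ f₂) l₂))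
    (λ g → let (g₁ , g₂) = to (∧≡true⇔ _ _) g in from (R₁-L₁ u s₁ t₁ linked₁ f₁) g₁ , from (R₂-L₂ u s₂ t₂ linked₂ f₂) g₂)
    where
    linked₁ = cong proj₁ st≡s , cong proj₁ tt≡t
    linked₂ = cong proj₂ st≡s , cong proj₂ tt≡t


module PowersetSemigroup where

  open import Data.Bool using (Bool; true; _∧_)
  open import Data.Bool.ListAction using (any)
  open import Data.Product using (Σ; _×_; _,_)
  open import Data.Fin using (Fin)
  open import Data.Vec using (Vec; lookup; tabulate)
  open import Data.Vec.Properties using (lookup∘tabulate; tabulate∘lookup; tabulate-cong)
  open import Function.Bundles using (_⇔_; mk⇔; Equivalence)
  open import Relation.Binary.PropositionalEquality using (_≡_; refl; sym; trans; cong)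
  open import Relation.Nullary.Decidable using (isYes)
  open Finiteness
  open BoolEquations
  open LinkedFactorisation
  open Equivalence

  module Powerset (S : FiniteSemigroup) where
    open FiniteSemigroup S

    Subset : Set
    Subset = Vec Bool (size fin)

    mem : T → Subset → Bool
    mem x X = lookup X (indexOf fin x)

    mem-tabulate : ∀ (f : Fin (size fin) → Bool) z → mem z (tabulate f) ≡ f (indexOf fin z)
    mem-tabulate f z = lookup∘tabulate f (indexOf fin z)

    mem-ext : ∀ (X Y : Subset) → (∀ z → mem z X ≡ mem z Y) → X ≡ Y
    mem-ext X Y e = trans (sym (tabulate∘lookup X)) (trans (tabulate-cong pointwise) (tabulate∘lookup Y))
      where
      pointwise : ∀ i → lookup X i ≡ lookup Y i
      pointwise i = trans (cong (lookup X) (sym (indexOf-elementAt fin i)))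
                      (trans (e (elementAt fin i)) (cong (lookup Y) (indexOf-elementAt fin i)))

    isProduct : Subset → Subset → T → Bool
    isProduct X Y z = any (λ x → any (λ y → mem x X ∧ (mem y Y ∧ isYes (decEq fin (x · y) z))) (enumerate fin)) (enumerate fin)

    _⊙_ : Subset → Subset → Subset
    X ⊙ Y = tabulate (λ i → isProduct X Y (elementAt fin i))

    mem-⊙ : ∀ X Y z → (mem z (X ⊙ Y) ≡ true) ⇔ (Σ T λ x → Σ T λ y → (mem x X ≡ true) × (mem y Y ≡ true) × (x · y ≡ z))
    mem-⊙ X Y z = mk⇔ product⇒ ⇒product
      where
      unfold : mem z (X ⊙ Y) ≡ isProduct X Y z
      unfold = trans (mem-tabulate _ z) (cong (isProduct X Y) (elementAt-indexOf fin z))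
      product⇒ : _
      product⇒ m with any-elim _ (enumerate fin) (trans (sym unfold) m)
      ... | x , m₂ with any-elim _ (enumerate fin) m₂
      ... | y , m₃ with to (∧≡true⇔ _ _) m₃
      ... | x∈X , m₄ with to (∧≡true⇔ _ _) m₄
      ... | y∈Y , xy = x , y , x∈X , y∈Y , to (isYes≡true⇔ (decEq fin (x · y) z)) xy
      ⇒product : _
      ⇒product (x , y , x∈X , y∈Y , xy≡z) = trans unfold (any-intro _ (∈-enumerate fin x)
        (any-intro _ (∈-enumerate fin y)
          (from (∧≡true⇔ _ _) (x∈X , from (∧≡true⇔ _ _) (y∈Y , from (isYes≡true⇔ (decEq fin (x · y) z)) xy≡z)))))

    ⊙-assoc : ∀ X Y Z → (X ⊙ Y) ⊙ Z ≡ X ⊙ (Y ⊙ Z)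
    ⊙-assoc X Y Z = mem-ext _ _ λ z → ≡true-ext (left⇒right z) (right⇒left z)
      where
      left⇒right : ∀ z → mem z ((X ⊙ Y) ⊙ Z) ≡ true → mem z (X ⊙ (Y ⊙ Z)) ≡ true
      left⇒right z m with to (mem-⊙ (X ⊙ Y) Z z) m
      ... | w , v , w∈XY , v∈Z , wv≡z with to (mem-⊙ X Y w) w∈XY
      ... | x , y , x∈X , y∈Y , xy≡w = from (mem-⊙ X (Y ⊙ Z) z)
        (x , y · v , x∈X , from (mem-⊙ Y Z (y · v)) (y , v , y∈Y , v∈Z , refl) ,
         trans (sym (assoc x y v)) (trans (cong (_· v) xy≡w) wv≡z))
      right⇒left : ∀ z → mem z (X ⊙ (Y ⊙ Z)) ≡ true → mem z ((X ⊙ Y) ⊙ Z) ≡ true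
      right⇒left z m with to (mem-⊙ X (Y ⊙ Z) z) m
      ... | x , w , x∈X , w∈YZ , xw≡z with to (mem-⊙ Y Z w) w∈YZ
      ... | y , v , y∈Y , v∈Z , yv≡w = from (mem-⊙ (X ⊙ Y) Z z)
        (x · y , v , from (mem-⊙ X Y (x · y)) (x , y , x∈X , y∈Y , refl) , v∈Z ,
         trans (assoc x y v) (trans (cong (x ·_) yv≡w) xw≡z))

    powersetSemigroup : FiniteSemigroup
    powersetSemigroup = record { T = Subset ; fin = Vec-finite Bool-finite (size fin) ; _·_ = _⊙_ ; assoc = ⊙-assoc }


module BlockPositions where

  open import Data.Nat using (ℕ; zero; suc; _+_; _≤_; _<_; z≤n; s≤s; _<?_)
  open import Data.Nat.Properties
  open import Data.Sum using (inj₁; inj₂)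
  open import Data.Empty using (⊥; ⊥-elim)
  open import Relation.Binary.PropositionalEquality using (_≡_; refl; sym; trans; cong; subst)
  open import Relation.Binary using (tri<; tri≈; tri>)
  open import Relation.Nullary using (yes; no)
  open LinkedFactorisation using (cut)

  module _ (c0 : ℕ) (d : ℕ → ℕ) where

    data Location (j : ℕ) : Set where
      inPrefix : j < c0 → Location j
      inBlock  : ∀ k r → j ≡ cut c0 d k + r → r < d k → Location j

    cut-step : ∀ k → cut c0 d k ≤ cut c0 d (suc k)
    cut-step k = m≤m+n _ _

    cut-mono : ∀ {a b} → a ≤ b → cut c0 d a ≤ cut c0 d b
    cut-mono {a} {zero} z≤n = ≤-refl
    cut-mono {a} {suc b} a≤b with m≤n⇒m<n∨m≡n a≤b
    ... | inj₁ (s≤s a≤b) = ≤-trans (cut-mono a≤b) (cut-step b)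
    ... | inj₂ refl = ≤-refl

    c0≤cut : ∀ k → c0 ≤ cut c0 d k
    c0≤cut k = cut-mono {0} {k} z≤n

    k≤cut : (∀ k → 0 < d k) → ∀ k → k ≤ cut c0 d k
    k≤cut d>0 zero = z≤n
    k≤cut d>0 (suc k) = subst (_≤ cut c0 d k + d k) (+-comm k 1) (+-mono-≤ (k≤cut d>0 k) (d>0 k))

    block-unique : ∀ {k r k′ r′} → cut c0 d k + r ≡ cut c0 d k′ + r′ → r < d k → r′ < d k′ → k ≡ k′
    block-unique {k} {r} {k′} {r′} e r<d r′<d with <-cmp k k′
    ... | tri≈ _ k≡k′ _ = k≡k′
    ... | tri< k<k′ _ _ = ⊥-elim (<-irrefl e
          (<-≤-trans (+-monoʳ-< (cut c0 d k) r<d) (≤-trans (cut-mono k<k′) (m≤m+n _ r′))))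
    ... | tri> _ _ k′<k = ⊥-elim (<-irrefl (sym e)
          (<-≤-trans (+-monoʳ-< (cut c0 d k′) r′<d) (≤-trans (cut-mono k′<k) (m≤m+n _ r))))

    prefix-disjoint-block : ∀ {j} k r → j < c0 → j ≡ cut c0 d k + r → ⊥
    prefix-disjoint-block k r j<c0 e =
      <-irrefl refl (<-≤-trans j<c0 (≤-trans (c0≤cut k) (≤-trans (m≤m+n _ r) (≤-reflexive (sym e)))))

    locate : (∀ k → 0 < d k) → ∀ j → Location j
    locate d>0 zero with 0 <? c0
    ... | yes 0<c0 = inPrefix 0<c0
    ... | no 0≮c0 = inBlock 0 0 (sym (trans (+-identityʳ c0) (n≤0⇒n≡0 (≮⇒≥ 0≮c0)))) (d>0 0)
    locate d>0 (suc j) with locate d>0 j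
    ... | inPrefix j<c0 with suc j <? c0
    ...   | yes sj<c0 = inPrefix sj<c0
    ...   | no sj≮c0 = inBlock 0 0 (trans (≤-antisym j<c0 (≮⇒≥ sj≮c0)) (sym (+-identityʳ c0))) (d>0 0)
    locate d>0 (suc j) | inBlock k r e r<d with suc r <? d k
    ...   | yes sr<d = inBlock k (suc r) (trans (cong suc e) (sym (+-suc _ r))) sr<d
    ...   | no sr≮d = inBlock (suc k) 0 (trans (cong suc e) (trans (sym (+-suc _ r))
                        (trans (cong (cut c0 d k +_) (≤-antisym r<d (≮⇒≥ sr≮d))) (sym (+-identityʳ _))))) (d>0 (suc k))

    selectByLocation : ∀ {X : Set} → (ℕ → X) → (ℕ → ℕ → X) → ∀ j → Location j → X
    selectByLocation fp fb j (inPrefix _) = fp j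
    selectByLocation fp fb j (inBlock k _ _ _) = fb k j

    selectByLocation-prefix : ∀ {X : Set} (fp : ℕ → X) fb {j} → j < c0 → (l : Location j) → selectByLocation fp fb j l ≡ fp j
    selectByLocation-prefix fp fb j<c0 (inPrefix _) = refl
    selectByLocation-prefix fp fb j<c0 (inBlock k r e _) = ⊥-elim (prefix-disjoint-block k r j<c0 e)

    selectByLocation-block : ∀ {X : Set} (fp : ℕ → X) fb k {r} → r < d k → (l : Location (cut c0 d k + r)) →
                             selectByLocation fp fb (cut c0 d k + r) l ≡ fb k (cut c0 d k + r)
    selectByLocation-block fp fb k {r} r<d (inPrefix p) = ⊥-elim (prefix-disjoint-block k r p refl)
    selectByLocation-block fp fb k r<d (inBlock k′ r′ e r′<d) rewrite block-unique e r<d r′<d = refl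


module Projection where

  open import Data.Nat using (ℕ; zero; suc; _+_; _∸_; _<_; s≤s; _≟_)
  open import Data.Nat.Properties
  open import Data.Bool using (Bool; true; false; _∧_; _∨_; if_then_else_)
  open import Data.Bool.ListAction using (any)
  open import Data.Maybe using (just)
  open import Data.Maybe.Properties using (just-injective)
  open import Data.Product using (Σ; _×_; _,_; proj₁; proj₂)
  open import Data.Sum using (inj₁; inj₂)
  open import Data.Empty using (⊥-elim)
  open import Data.Vec using (tabulate)
  open import Function using (_∘_)
  open import Function.Bundles using (_⇔_; mk⇔; Equivalence)
  open import Relation.Binary.PropositionalEquality
  open import Relation.Nullary using (¬_; yes; no)
  open import Relation.Nullary.Decidable using (isYes)
  open Finiteness
  open BoolEquations
  open InfiniteRamsey using (Increasing; increasing⇒strictMono)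
  open LinkedFactorisation
  open PowersetSemigroup
  open BlockPositions
  open Equivalence

  update : (ℕ → Bool) → ℕ → Bool → ℕ → Bool
  update Y p b j = if isYes (j ≟ p) then b else Y j

  update-same : ∀ Y p b → update Y p b p ≡ b
  update-same Y p b with p ≟ p
  ... | yes _ = refl
  ... | no p≢p = ⊥-elim (p≢p refl)

  update-other : ∀ Y p b {j} → ¬ (j ≡ p) → update Y p b j ≡ Y j
  update-other Y p b {j} j≢p with j ≟ p
  ... | yes j≡p = ⊥-elim (j≢p j≡p)
  ... | no _ = refl

  _⊗_ : ∀ {A : Set} → (ℕ → A) → (ℕ → Bool) → ℕ → A × Bool
  (u ⊗ Y) i = u i , Y i

  -- Existential quantification of a set variable: a letter a is sent to {h (a, false), h (a, true)}
  -- in the powerset semigroup, and a pair of subsets is good when it contains a good linked pair.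
  module Project {A : Set} (R : Recognizer (A × Bool)) where
    open Recognizer R using (h; good)
    open Factorisation (Recognizer.sg R)
    open Powerset (Recognizer.sg R)
    private module P = Factorisation powersetSemigroup

    hProj : A → Subset
    hProj a = tabulate (λ i → isYes (decEq fin (h (a , false)) (elementAt fin i)) ∨ isYes (decEq fin (h (a , true)) (elementAt fin i)))

    mem-hProj : ∀ a x → (mem x (hProj a) ≡ true) ⇔ (Σ Bool λ b → h (a , b) ≡ x)
    mem-hProj a x = mk⇔ mem⇒ ⇒mem
      where
      unfold : mem x (hProj a) ≡ isYes (decEq fin (h (a , false)) x) ∨ isYes (decEq fin (h (a , true)) x)
      unfold = trans (mem-tabulate _ x)
        (cong (λ z → isYes (decEq fin (h (a , false)) z) ∨ isYes (decEq fin (h (a , true)) z)) (elementAt-indexOf fin x))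
      mem⇒ : _
      mem⇒ m with to (∨≡true⇔ _ _) (trans (sym unfold) m)
      ... | inj₁ p = false , to (isYes≡true⇔ (decEq fin _ _)) p
      ... | inj₂ p = true , to (isYes≡true⇔ (decEq fin _ _)) p
      ⇒mem : _
      ⇒mem (false , p) = trans unfold (from (∨≡true⇔ _ _) (inj₁ (from (isYes≡true⇔ (decEq fin _ _)) p)))
      ⇒mem (true , p) = trans unfold (from (∨≡true⇔ _ _) (inj₂ (from (isYes≡true⇔ (decEq fin _ _)) p)))

    goodProj : Subset → Subset → Bool
    goodProj X Y = any (λ s → any (λ t → mem s X ∧ (mem t Y ∧ (linked? s t ∧ good s t))) (enumerate fin)) (enumerate fin)

    goodProj-intro : ∀ X Y s t → mem s X ≡ true → mem t Y ≡ true → Linked s t → good s t ≡ true → goodProj X Y ≡ true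
    goodProj-intro X Y s t s∈X t∈Y linked g = any-intro _ (∈-enumerate fin s) (any-intro _ (∈-enumerate fin t)
      (from (∧≡true⇔ _ _) (s∈X , from (∧≡true⇔ _ _) (t∈Y , from (∧≡true⇔ _ _) (from (linked?≡true⇔ s t) linked , g)))))

    goodProj-elim : ∀ X Y → goodProj X Y ≡ true →
      Σ T λ s → Σ T λ t → (mem s X ≡ true) × (mem t Y ≡ true) × Linked s t × (good s t ≡ true)
    goodProj-elim X Y e with any-elim _ (enumerate fin) e
    ... | s , e₁ with any-elim _ (enumerate fin) e₁
    ... | t , e₂ with to (∧≡true⇔ _ _) e₂
    ... | s∈X , e₃ with to (∧≡true⇔ _ _) e₃
    ... | t∈Y , e₄ with to (∧≡true⇔ _ _) e₄
    ... | l , g = s , t , s∈X , t∈Y , to (linked?≡true⇔ s t) l , g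

    projectR : Recognizer A
    projectR = record { sg = powersetSemigroup ; h = hProj ; good = goodProj }

    val-∈-projection : ∀ u Y i l {x X} → val (h ∘ (u ⊗ Y)) i l ≡ just x → P.val (hProj ∘ u) i l ≡ just X → mem x X ≡ true
    val-∈-projection u Y i zero () _
    val-∈-projection u Y i (suc zero) refl refl = from (mem-hProj _ _) (Y (i + 0) , refl)
    val-∈-projection u Y i (suc (suc l)) {x} {X} e E =
      subst₂ (λ a b → mem a b ≡ true)
        (just-injective (trans (sym (cong (_⊕ just (h (a , Y p))) e₀)) e))
        (just-injective (trans (sym (cong (P._⊕ just (hProj a)) E₀)) E))
        (from (mem-⊙ X₀ (hProj a) (x₀ · h (a , Y p)))
          (x₀ , h (a , Y p) , val-∈-projection u Y i (suc l) e₀ E₀ , from (mem-hProj a (h (a , Y p))) (Y p , refl) , refl))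
      where
      p = i + suc l
      a = u p
      x₀ = proj₁ (val-suc-just (h ∘ (u ⊗ Y)) i l)
      e₀ = proj₂ (val-suc-just (h ∘ (u ⊗ Y)) i l)
      X₀ = proj₁ (P.val-suc-just (hProj ∘ u) i l)
      E₀ = proj₂ (P.val-suc-just (hProj ∘ u) i l)

    projection-realised-suc : ∀ u i l {X x} → P.val (hProj ∘ u) i (suc l) ≡ just X → mem x X ≡ true →
                              Σ (ℕ → Bool) λ Y → val (h ∘ (u ⊗ Y)) i (suc l) ≡ just x
    projection-realised-suc u i zero refl x∈X with to (mem-hProj _ _) x∈X
    ... | b , hb≡x = (λ _ → b) , cong just hb≡x
    projection-realised-suc u i (suc l) {X} {x} E x∈X with P.val-suc-just (hProj ∘ u) i l
    ... | X₀ , E₀ with to (mem-⊙ X₀ (hProj (u (i + suc l))) x)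
                        (subst (λ Z → mem x Z ≡ true) (sym (just-injective (trans (sym (cong (P._⊕ just (hProj (u (i + suc l)))) E₀)) E))) x∈X)
    ... | x₀ , y , x₀∈X₀ , y∈h , x₀y≡x with to (mem-hProj (u (i + suc l)) y) y∈h | projection-realised-suc u i l E₀ x₀∈X₀
    ... | b , hb≡y | Y₀ , e₀ = update Y₀ p b , realised
      where
      p = i + suc l
      unchanged : val (h ∘ (u ⊗ update Y₀ p b)) i (suc l) ≡ val (h ∘ (u ⊗ Y₀)) i (suc l)
      unchanged = val-local i (suc l) λ r r<l → cong (λ z → h (u (i + r) , z))
                    (update-other Y₀ p b λ eq → <-irrefl (+-cancelˡ-≡ i r (suc l) eq) r<l)
      realised : val (h ∘ (u ⊗ update Y₀ p b)) i (suc (suc l)) ≡ just x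
      realised rewrite unchanged | e₀ | update-same Y₀ p b = cong just (trans (cong (x₀ ·_) hb≡y) x₀y≡x)

    projection-realised : ∀ u i l {X x} → P.val (hProj ∘ u) i l ≡ just X → mem x X ≡ true →
                          Σ (ℕ → Bool) λ Y → val (h ∘ (u ⊗ Y)) i l ≡ just x
    projection-realised u i zero () _
    projection-realised u i (suc l) = projection-realised-suc u i l

    module _ (em : ExcludedMiddle) (L : (ℕ → A × Bool) → Set) (R-L : Recognizes R L) (u : ℕ → A)
             (S U : Subset) (linkedSU : P.Linked S U) (f : P.Factorises (hProj ∘ u) S U) where
      open P.Factorises f

      d>0 : ∀ k → 0 < d k
      d>0 k = P.val-just⇒positive (blk k)

      q : ℕ → ℕ
      q = cut c0 d

      q-increasing : Increasing q
      q-increasing k = subst (_< q (suc k)) (+-identityʳ (q k)) (+-monoʳ-< (q k) (d>0 k))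

      prefixVal : ∀ m → P.val (hProj ∘ u) 0 (q m) ≡ just S
      prefixVal zero = pre
      prefixVal (suc m) = trans (P.val-+ (hProj ∘ u) 0 (q m) (d m)) (trans (cong₂ P._⊕_ (prefixVal m) (blk m)) (cong just (proj₁ linkedSU)))

      blockVal-suc : ∀ a → P.val (hProj ∘ u) (q a) (q (suc a) ∸ q a) ≡ just U
      blockVal-suc a = trans (cong (P.val (hProj ∘ u) (q a)) (m+n∸m≡n (q a) (d a))) (blk a)

      blockVal : ∀ {a b} → a < b → P.val (hProj ∘ u) (q a) (q b ∸ q a) ≡ just U
      blockVal {a} {suc b} (s≤s a≤b) with m≤n⇒m<n∨m≡n a≤b
      ... | inj₂ refl = blockVal-suc a
      ... | inj₁ a<b = trans (P.val-∸ (hProj ∘ u) (cut-mono c0 d a≤b) (cut-step c0 d b))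
                         (trans (cong₂ P._⊕_ (blockVal a<b) (blockVal-suc b)) (cong just (proj₂ linkedSU)))

      -- Refine the given cut points by Ramsey so that the labelled word is linked along them too.
      labelled⇒goodProj : (Σ (ℕ → Bool) λ Y → L (u ⊗ Y)) → goodProj S U ≡ true
      labelled⇒goodProj (Y , l) = fromRefinement (factorise-along em (h ∘ (u ⊗ Y)) q q-increasing)
        where
        fromRefinement : LinkedFactorisationAlong (h ∘ (u ⊗ Y)) q → goodProj S U ≡ true
        fromRefinement (s , t , k , k-inc , linked , pre′ , blk′) =
          goodProj-intro S U s t (val-∈-projection u Y 0 (q (k 0)) pre′ (prefixVal (k 0)))
                             (val-∈-projection u Y (q (k 0)) (q (k 1) ∸ q (k 0)) (blk′ 0) (blockVal (k-inc 0)))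
                             linked (to (R-L (u ⊗ Y) s t linked fact) l)
          where
          fact = factorises-fromCuts _ (λ i → q (k i)) t (λ i → increasing⇒strictMono q q-increasing (k-inc i)) blk′ s pre′

      -- Realise s on the prefix and t on every block independently, then glue the labellings.
      goodProj⇒labelled : goodProj S U ≡ true → Σ (ℕ → Bool) λ Y → L (u ⊗ Y)
      goodProj⇒labelled g = fromPair (goodProj-elim S U g)
        where
        fromPair : (Σ T λ s → Σ T λ t → (mem s S ≡ true) × (mem t U ≡ true) × Linked s t × (good s t ≡ true)) →
                   Σ (ℕ → Bool) λ Y → L (u ⊗ Y)
        fromPair (s , t , s∈S , t∈U , linked , gd) = Y , from (R-L (u ⊗ Y) s t linked fact) gd
          where
          onPrefix : Σ (ℕ → Bool) λ Y → val (h ∘ (u ⊗ Y)) 0 c0 ≡ just s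
          onPrefix = projection-realised u 0 c0 pre s∈S
          onBlock : ∀ k → Σ (ℕ → Bool) λ Y → val (h ∘ (u ⊗ Y)) (q k) (d k) ≡ just t
          onBlock k = projection-realised u (q k) (d k) (blk k) t∈U
          Y : ℕ → Bool
          Y j = selectByLocation c0 d (proj₁ onPrefix) (λ k → proj₁ (onBlock k)) j (locate c0 d d>0 j)
          fact : Factorises (h ∘ (u ⊗ Y)) s t
          fact = record
            { c0 = c0 ; d = d
            ; pre = trans (val-local 0 c0 λ r r<c0 → cong (λ z → h (u r , z))
                      (selectByLocation-prefix c0 d (proj₁ onPrefix) _ r<c0 (locate c0 d d>0 r))) (proj₂ onPrefix)
            ; blk = λ k → trans (val-local (q k) (d k) λ r r<d → cong (λ z → h (u (q k + r) , z))
                      (selectByLocation-block c0 d (proj₁ onPrefix) (λ k → proj₁ (onBlock k)) k r<d (locate c0 d d>0 (q k + r)))) (proj₂ (onBlock k)) }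

    projectR-recognizes : ExcludedMiddle → ∀ L → Recognizes R L → Recognizes projectR (λ u → Σ (ℕ → Bool) λ Y → L (u ⊗ Y))
    projectR-recognizes em L R-L u S U linked f = mk⇔ (labelled⇒goodProj em L R-L u S U linked f) (goodProj⇒labelled em L R-L u S U linked f)


module SafetyAutomata where

  open import Data.Nat using (ℕ; zero; suc; _+_; _<_; s≤s)
  open import Data.Nat.Properties
  open import Data.Bool using (Bool; true; false; if_then_else_)
  open import Data.Maybe using (Maybe; just; nothing; is-just; _>>=_)
  open import Data.Maybe.Properties using (just-injective)
  open import Data.Product using (Σ; _×_; _,_; proj₁; proj₂)
  open import Data.Sum using (inj₁; inj₂)
  open import Function using (_∘′_)
  open import Function.Bundles using (mk⇔)
  open import Relation.Binary.PropositionalEquality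
  open Finiteness
  open LinkedFactorisation
  open BlockPositions using (k≤cut)

  -- A deterministic automaton with two states which must keep allowed true forever.
  record SafetyAutomaton (A : Set) : Set where
    field
      start   : Bool
      allowed : Bool → A → Bool
      next    : Bool → A → Bool

  module _ {A : Set} (M : SafetyAutomaton A) where
    open SafetyAutomaton M

    state : (ℕ → A) → ℕ → Bool
    state u zero = start
    state u (suc n) = next (state u n) (u n)

    Safe : (ℕ → A) → Set
    Safe u = ∀ n → allowed (state u n) (u n) ≡ true

    step : Bool → A → Maybe Bool
    step q a = if allowed q a then just (next q a) else nothing

    -- Partial maps Bool ⇀ Bool, tabulated as the pair of their values at false and true.
    PartialMap : Set
    PartialMap = Maybe Bool × Maybe Bool

    apply : PartialMap → Bool → Maybe Bool
    apply (a , b) false = a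
    apply (a , b) true = b

    _∙_ : PartialMap → PartialMap → PartialMap
    f ∙ g = (apply f false >>= apply g) , (apply f true >>= apply g)

    apply-∙ : ∀ f g q → apply (f ∙ g) q ≡ (apply f q >>= apply g)
    apply-∙ f g false = refl
    apply-∙ f g true = refl

    >>=-assoc : ∀ (m : Maybe Bool) (f g : Bool → Maybe Bool) → ((m >>= f) >>= g) ≡ (m >>= λ x → f x >>= g)
    >>=-assoc nothing f g = refl
    >>=-assoc (just x) f g = refl

    >>=-apply-∙ : ∀ (m : Maybe Bool) f g → ((m >>= apply f) >>= apply g) ≡ (m >>= apply (f ∙ g))
    >>=-apply-∙ nothing f g = refl
    >>=-apply-∙ (just false) f g = refl
    >>=-apply-∙ (just true) f g = refl

    partialMaps : FiniteSemigroup
    partialMaps = record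
      { T = PartialMap ; fin = ×-finite (Maybe-finite Bool-finite) (Maybe-finite Bool-finite) ; _·_ = _∙_
      ; assoc = λ f g k → cong₂ _,_ (>>=-apply-∙ (apply f false) g k) (>>=-apply-∙ (apply f true) g k) }

    stepMap : A → PartialMap
    stepMap a = step false a , step true a

    safetyR : Recognizer A
    safetyR = record { sg = partialMaps ; h = stepMap ; good = λ s t → is-just (apply s start) }

    open Factorisation partialMaps

    run : (ℕ → A) → ℕ → ℕ → Bool → Maybe Bool
    run u i zero q = just q
    run u i (suc l) q = run u i l q >>= λ q′ → step q′ (u (i + l))

    run-+ : ∀ u i l₁ l₂ q → run u i (l₁ + l₂) q ≡ (run u i l₁ q >>= run u (i + l₁) l₂)
    run-+ u i l₁ zero q rewrite +-identityʳ l₁ with run u i l₁ q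
    ... | nothing = refl
    ... | just _ = refl
    run-+ u i l₁ (suc l₂) q rewrite +-suc l₁ l₂ | run-+ u i l₁ l₂ q | +-assoc i l₁ l₂ =
      >>=-assoc (run u i l₁ q) _ _

    apply-val : ∀ u i l {f} → val (stepMap ∘′ u) i l ≡ just f → ∀ q → apply f q ≡ run u i l q
    apply-val u i zero () q
    apply-val u i (suc zero) refl false = refl
    apply-val u i (suc zero) refl true = refl
    apply-val u i (suc (suc l)) {f} e q = begin
      apply f q                                     ≡⟨ cong (λ z → apply z q) (just-injective (trans (sym e) (cong (_⊕ just g) e₀))) ⟩
      apply (f₀ ∙ g) q                              ≡⟨ apply-∙ f₀ g q ⟩
      (apply f₀ q >>= apply g)                      ≡⟨ >>=-step (apply f₀ q) ⟩
      (apply f₀ q >>= λ q′ → step q′ a)             ≡⟨ cong (_>>= λ q′ → step q′ a) (apply-val u i (suc l) e₀ q) ⟩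
      (run u i (suc l) q >>= λ q′ → step q′ a)      ∎
      where
      open ≡-Reasoning
      a = u (i + suc l)
      g = stepMap a
      f₀ = proj₁ (val-suc-just (stepMap ∘′ u) i l)
      e₀ = proj₂ (val-suc-just (stepMap ∘′ u) i l)
      >>=-step : ∀ m → (m >>= apply g) ≡ (m >>= λ q′ → step q′ a)
      >>=-step nothing = refl
      >>=-step (just false) = refl
      >>=-step (just true) = refl

    run-safe-prefix : ∀ u n → (∀ m → m < n → allowed (state u m) (u m) ≡ true) → run u 0 n start ≡ just (state u n)
    run-safe-prefix u zero safe = refl
    run-safe-prefix u (suc n) safe
      rewrite run-safe-prefix u n (λ m m<n → safe m (m<n⇒m<1+n m<n)) | safe n (n<1+n n) = refl

    run-just⇒safe-prefix : ∀ u n {q} → run u 0 n start ≡ just q → (q ≡ state u n) × (∀ m → m < n → allowed (state u m) (u m) ≡ true)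
    run-just⇒safe-prefix u zero refl = refl , λ m ()
    run-just⇒safe-prefix u (suc n) e with run u 0 n start in eq
    run-just⇒safe-prefix u (suc n) () | nothing
    ... | just q′ with run-just⇒safe-prefix u n eq
    ... | refl , safe with allowed (state u n) (u n) in allowed-n
    run-just⇒safe-prefix u (suc n) () | just _ | refl , _ | false
    ... | true = sym (just-injective e) , safe-suc
      where
      safe-suc : ∀ m → m < suc n → allowed (state u m) (u m) ≡ true
      safe-suc m (s≤s m≤n) with m≤n⇒m<n∨m≡n m≤n
      ... | inj₁ m<n = safe m m<n
      ... | inj₂ refl = allowed-n

    is-just≡true : ∀ {m : Maybe Bool} → is-just m ≡ true → Σ Bool λ q → m ≡ just q
    is-just≡true {just q} _ = q , refl

    -- Safety is decided by s alone: s applied to start is defined iff the run survives the prefix,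
    -- and t (idempotent, with s·t = s) maps the reached state back to itself on every block.
    safetyR-recognizes : Recognizes safetyR Safe
    safetyR-recognizes u s t (s·t≡s , _) f = mk⇔ safe⇒ ⇒safe
      where
      open Factorises f
      safe⇒ : Safe u → is-just (apply s start) ≡ true
      safe⇒ safe rewrite apply-val u 0 c0 pre start | run-safe-prefix u c0 (λ m _ → safe m) = refl
      ⇒safe : is-just (apply s start) ≡ true → Safe u
      ⇒safe defined n = proj₂ (run-just⇒safe-prefix u (cut c0 d (suc n)) (run-to-cut (suc n))) n
                          (≤-trans (n<1+n n) (k≤cut c0 d d>0 (suc n)))
        where
        q = proj₁ (is-just≡true defined)
        s-start : apply s start ≡ just q
        s-start = proj₂ (is-just≡true defined)
        d>0 : ∀ k → 0 < d k
        d>0 k = val-just⇒positive (blk k)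
        t-fixes-q : apply t q ≡ just q
        t-fixes-q = begin
          apply t q                        ≡⟨ cong (_>>= apply t) s-start ⟨
          (apply s start >>= apply t)      ≡⟨ apply-∙ s t start ⟨
          apply (s ∙ t) start              ≡⟨ cong (λ z → apply z start) s·t≡s ⟩
          apply s start                    ≡⟨ s-start ⟩
          just q                           ∎
          where open ≡-Reasoning
        run-to-cut : ∀ k → run u 0 (cut c0 d k) start ≡ just q
        run-to-cut zero = trans (sym (apply-val u 0 c0 pre start)) s-start
        run-to-cut (suc k) = begin
          run u 0 (cut c0 d k + d k) start                           ≡⟨ run-+ u 0 (cut c0 d k) (d k) start ⟩
          (run u 0 (cut c0 d k) start >>= run u (cut c0 d k) (d k))  ≡⟨ cong (_>>= run u (cut c0 d k) (d k)) (run-to-cut k) ⟩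
          run u (cut c0 d k) (d k) q                                 ≡⟨ apply-val u (cut c0 d k) (d k) (blk k) q ⟨
          apply t q                                                  ≡⟨ t-fixes-q ⟩
          just q                                                     ∎
          where open ≡-Reasoning


module SetMSO where

  open import Data.Nat using (ℕ; suc)
  open import Data.Fin using (Fin)
  open import Data.Bool using (Bool; true; false; not; _∧_; _∨_)
  open import Data.Vec using (Vec; lookup; _∷_)
  open import Data.Product using (Σ; _×_; _,_)
  open import Relation.Nullary using (¬_)
  open BoolEquations using (iffᵇ)
  open LinkedFactorisation
  open BooleanClosure
  open Projection
  open SafetyAutomata

  -- The truth values of m letter predicates, followed by the memberships in c set variables.
  Letter : ℕ → ℕ → Set
  Letter m c = Vec Bool m × Vec Bool c

  -- X i ⊆ X j, X i = ∅, X i = {0}, X j = X i + 1, every element of X j has an element of X i below it,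
  -- and X i ⊆ P k.
  data Atom (m c : ℕ) : Set where
    Sub  : Fin c → Fin c → Atom m c
    Emp  : Fin c → Atom m c
    Zero : Fin c → Atom m c
    Succ : Fin c → Fin c → Atom m c
    Less : Fin c → Fin c → Atom m c
    Pk   : Fin m → Fin c → Atom m c

  atomAutomaton : ∀ {m c} → Atom m c → SafetyAutomaton (Letter m c)
  atomAutomaton (Sub i j) = record
    { start = false ; allowed = λ _ (_ , X) → not (lookup X i ∧ not (lookup X j)) ; next = λ q _ → q }
  atomAutomaton (Emp i) = record
    { start = false ; allowed = λ _ (_ , X) → not (lookup X i) ; next = λ q _ → q }
  atomAutomaton (Zero i) = record
    { start = true ; allowed = λ q (_ , X) → iffᵇ (lookup X i) q ; next = λ _ _ → false }
  atomAutomaton (Succ i j) = record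
    { start = false ; allowed = λ q (_ , X) → iffᵇ (lookup X j) q ; next = λ _ (_ , X) → lookup X i }
  atomAutomaton (Less i j) = record
    { start = false ; allowed = λ q (_ , X) → not (lookup X j ∧ not q) ; next = λ q (_ , X) → q ∨ lookup X i }
  atomAutomaton (Pk k i) = record
    { start = false ; allowed = λ _ (p , X) → not (lookup X i ∧ not (lookup p k)) ; next = λ q _ → q }

  data SetFormula (m : ℕ) : ℕ → Set where
    atom : ∀ {c} → Atom m c → SetFormula m c
    neg  : ∀ {c} → SetFormula m c → SetFormula m c
    and  : ∀ {c} → SetFormula m c → SetFormula m c → SetFormula m c
    ex   : ∀ {c} → SetFormula m (suc c) → SetFormula m c

  consLetter : ∀ {m c} → Letter m c × Bool → Letter m (suc c)
  consLetter ((p , X) , b) = p , b ∷ X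

  cons : ∀ {m c} → (ℕ → Letter m c) → (ℕ → Bool) → ℕ → Letter m (suc c)
  cons u Y n = consLetter (u n , Y n)

  SatSet : ∀ {m c} → SetFormula m c → (ℕ → Letter m c) → Set
  SatSet (atom α) u = Safe (atomAutomaton α) u
  SatSet (neg φ) u = ¬ SatSet φ u
  SatSet (and φ ψ) u = SatSet φ u × SatSet ψ u
  SatSet (ex φ) u = Σ (ℕ → Bool) λ Y → SatSet φ (cons u Y)

  recognizer : ∀ {m c} → SetFormula m c → Recognizer (Letter m c)
  recognizer (atom α) = safetyR (atomAutomaton α)
  recognizer (neg φ) = complementR (recognizer φ)
  recognizer (and φ ψ) = intersectionR (recognizer φ) (recognizer ψ)
  recognizer (ex φ) = Project.projectR (comapR consLetter (recognizer φ))

  recognizer-recognizes : ExcludedMiddle → ∀ {m c} (φ : SetFormula m c) → Recognizes (recognizer φ) (SatSet φ)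
  recognizer-recognizes em (atom α) = safetyR-recognizes (atomAutomaton α)
  recognizer-recognizes em (neg φ) =
    complementR-recognizes (recognizer φ) (SatSet φ) (recognizer-recognizes em φ)
  recognizer-recognizes em (and φ ψ) =
    intersectionR-recognizes (recognizer φ) (recognizer ψ) (SatSet φ) (SatSet ψ) (recognizer-recognizes em φ) (recognizer-recognizes em ψ)
  recognizer-recognizes em (ex φ) =
    Project.projectR-recognizes (comapR consLetter (recognizer φ)) em _ (comapR-recognizes consLetter (recognizer φ) (SatSet φ) (recognizer-recognizes em φ))


module ListAutomata where

  open import Data.Nat using (ℕ; suc; _≤_)
  open import Data.Bool using (Bool; true; false; _∧_; if_then_else_)
  open import Data.Maybe using (Maybe; just; nothing)
  open import Data.Product using (Σ; _×_; _,_; proj₁; proj₂)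
  open import Data.Sum using (_⊎_; inj₁; inj₂)
  open import Data.Empty using (⊥-elim)
  open import Data.List using (List; []; _∷_; map; concatMap)
  open import Data.List.Membership.Propositional using (_∈_; lose; find)
  open import Data.List.Membership.Propositional.Properties using (∈-map⁺; ∈-map⁻; ∈-concatMap⁺; ∈-concatMap⁻)
  open import Data.List.Relation.Unary.Any using (here; there)
  open import Function.Bundles using (Equivalence)
  open import Relation.Binary.PropositionalEquality using (_≡_; refl)
  open import Relation.Nullary using (yes; no)
  open import Relation.Nullary.Decidable using (isYes)
  open Finiteness
  open BoolEquations
  open LinkedFactorisation
  open Equivalence

  -- Büchi automata whose transitions read letters rather than formulas.
  record ListAutomaton (A : Set) : Set₁ where
    field
      Q    : Set
      finQ : Finite Q
      q0   : Q
      succ : Q → A → List Q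
      acc  : Q → Bool

  AcceptsLA : ∀ {A} → ListAutomaton A → (ℕ → A) → Set
  AcceptsLA M u = Σ (ℕ → Q) λ ρ → (ρ 0 ≡ q0) × (∀ i → ρ (suc i) ∈ succ (ρ i) (u i)) × (∀ i → Σ ℕ λ j → i ≤ j × acc (ρ j) ≡ true)
    where open ListAutomaton M

  ∈-concatMap-intro : ∀ {X Y : Set} (f : X → List Y) {xs x y} → x ∈ xs → y ∈ f x → y ∈ concatMap f xs
  ∈-concatMap-intro f x∈xs y∈fx = ∈-concatMap⁺ f (lose x∈xs y∈fx)

  ∈-concatMap-elim : ∀ {X Y : Set} (f : X → List Y) xs {y} → y ∈ concatMap f xs → Σ X λ x → y ∈ f x
  ∈-concatMap-elim f xs y∈ = let (x , _ , y∈fx) = find (∈-concatMap⁻ f {xs} y∈) in x , y∈fx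

  ∈-if-elim : ∀ {X : Set} b {x y : X} → y ∈ (if b then x ∷ [] else []) → (b ≡ true) × y ≡ x
  ∈-if-elim true (here refl) = refl , refl

  -- The automaton guesses a good linked pair (s, t) and then the cut points of a factorisation:
  -- a state (s, t, inBlocks, x, fresh) records the value x of the current segment and whether it has
  -- just begun; a segment may be closed once x equals its target (s for the prefix, t for blocks).
  module Automaton {A : Set} (R : Recognizer A) where
    open Recognizer R
    open Factorisation sg

    State : Set
    State = T × T × Bool × T × Bool

    segmentTarget : Bool → T → T → T
    segmentTarget true s t = t
    segmentTarget false s t = s

    goodLinked? : T → T → Bool
    goodLinked? s t = linked? s t ∧ good s t

    goodLinkedPairs : List (T × T)
    goodLinkedPairs = concatMap (λ s → concatMap (λ t → if goodLinked? s t then (s , t) ∷ [] else []) (enumerate fin)) (enumerate fin)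

    succQ : Maybe State → A → List (Maybe State)
    succQ nothing a = map (λ (s , t) → just (s , t , false , h a , false)) goodLinkedPairs
    succQ (just (s , t , inBlocks , x , _)) a = just (s , t , inBlocks , x · h a , false) ∷
       (if isYes (decEq fin x (segmentTarget inBlocks s t)) then just (s , t , true , h a , true) ∷ [] else [])

    accQ : Maybe State → Bool
    accQ nothing = false
    accQ (just (_ , _ , _ , _ , fresh)) = fresh

    automaton : ListAutomaton A
    automaton = record
      { Q = Maybe State ; finQ = Maybe-finite (×-finite fin (×-finite fin (×-finite Bool-finite (×-finite fin Bool-finite))))
      ; q0 = nothing ; succ = succQ ; acc = accQ }

    ∈-succQ-start : ∀ {s t q′} a → Linked s t → good s t ≡ true → q′ ≡ just (s , t , false , h a , false) → q′ ∈ succQ nothing a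
    ∈-succQ-start {s} {t} a linked g refl =
      ∈-map⁺ _ (∈-concatMap-intro _ (∈-enumerate fin s) (∈-concatMap-intro _ (∈-enumerate fin t) chosen))
      where
      chosen : (s , t) ∈ (if goodLinked? s t then (s , t) ∷ [] else [])
      chosen rewrite from (∧≡true⇔ _ _) (from (linked?≡true⇔ s t) linked , g) = here refl

    succQ-start-elim : ∀ a {q′} → q′ ∈ succQ nothing a →
      Σ T λ s → Σ T λ t → Linked s t × good s t ≡ true × q′ ≡ just (s , t , false , h a , false)
    succQ-start-elim a m with ∈-map⁻ _ m
    ... | _ , p∈ , refl with ∈-concatMap-elim _ (enumerate fin) p∈
    ... | s , p∈s with ∈-concatMap-elim _ (enumerate fin) p∈s
    ... | t , p∈st with ∈-if-elim (goodLinked? s t) p∈st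
    ... | gl , refl = s , t , to (linked?≡true⇔ s t) (proj₁ (to (∧≡true⇔ _ _) gl)) , proj₂ (to (∧≡true⇔ _ _) gl) , refl

    ∈-succQ-continue : ∀ s t b x f a {q′} → q′ ≡ just (s , t , b , x · h a , false) → q′ ∈ succQ (just (s , t , b , x , f)) a
    ∈-succQ-continue s t b x f a refl = here refl

    ∈-succQ-close : ∀ s t b x f a {q′} → x ≡ segmentTarget b s t → q′ ≡ just (s , t , true , h a , true) →
                    q′ ∈ succQ (just (s , t , b , x , f)) a
    ∈-succQ-close s t b x f a x≡target refl with decEq fin x (segmentTarget b s t)
    ... | yes _ = there (here refl)
    ... | no x≢target = ⊥-elim (x≢target x≡target)

    succQ-step-elim : ∀ s t b x f a {q′} → q′ ∈ succQ (just (s , t , b , x , f)) a →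
      (q′ ≡ just (s , t , b , x · h a , false)) ⊎ ((x ≡ segmentTarget b s t) × (q′ ≡ just (s , t , true , h a , true)))
    succQ-step-elim s t b x f a (here e) = inj₁ e
    succQ-step-elim s t b x f a (there m) with ∈-if-elim (isYes (decEq fin x (segmentTarget b s t))) m
    ... | e , e′ = inj₂ (to (isYes≡true⇔ (decEq fin _ _)) e , e′)


module AutomatonOfRecognizer where

  open import Data.Nat using (ℕ; zero; suc; _+_; _∸_; _≤_; _<_; z≤n; s≤s; _<?_)
  open import Data.Nat.Properties
  open import Data.Bool using (Bool; true; false)
  open import Data.Maybe using (Maybe; just; nothing)
  open import Data.Maybe.Properties using (just-injective)
  open import Data.Product using (Σ; _×_; _,_; proj₁; proj₂)
  open import Data.Sum using (_⊎_; inj₁; inj₂)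
  open import Data.Empty using (⊥; ⊥-elim)
  open import Data.List.Membership.Propositional using (_∈_)
  open import Function using (_∘_)
  open import Function.Bundles using (_⇔_; mk⇔; Equivalence)
  open import Relation.Binary.PropositionalEquality
  open import Relation.Nullary using (yes; no)
  open InfiniteRamsey using (module NextTrue)
  open LinkedFactorisation
  open BlockPositions
  open BoolEquations using (false≢true)
  open ListAutomata

  open Equivalence

  isZero : ℕ → Bool
  isZero zero = true
  isZero (suc _) = false

  module RunOfFactorisation {A : Set} (R : Recognizer A) (u : ℕ → A) (s t : FiniteSemigroup.T (Recognizer.sg R)) (linked : Factorisation.Linked (Recognizer.sg R) s t)
             (isGood : Recognizer.good R s t ≡ true) (f : Factorisation.Factorises (Recognizer.sg R) (Recognizer.h R ∘ u) s t) where
    open Recognizer R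
    open Factorisation sg
    open Automaton R
    open Factorises f

    hu : ℕ → T
    hu = h ∘ u

    d>0 : ∀ k → 0 < d k
    d>0 k with d k | blk k
    ... | zero | ()
    ... | suc _ | _ = s≤s z≤n

    c0>0 : 0 < c0
    c0>0 with c0 | pre
    ... | zero | ()
    ... | suc _ | _ = s≤s z≤n

    cuts : ℕ → ℕ
    cuts = cut c0 d

    stateAt : ∀ j → Location c0 d j → Maybe State
    stateAt j (inPrefix _) = just (s , t , false , segment hu 0 j , false)
    stateAt j (inBlock k r _ _) = just (s , t , true , segment hu (cuts k) r , isZero r)

    location : ∀ j → Location c0 d j
    location = locate c0 d d>0

    ρ : ℕ → Maybe State
    ρ zero = nothing
    ρ (suc j) = stateAt j (location j)

    step-first : ∀ (l : Location c0 d 0) → stateAt 0 l ∈ succQ nothing (u 0)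
    step-first (inPrefix _) = ∈-succQ-start (u 0) linked isGood (cong (λ z → just (s , t , false , z , false)) (segment-zero hu 0))
    step-first (inBlock k r e _) = ⊥-elim (prefix-disjoint-block c0 d k r c0>0 e)

    step-in-prefix : ∀ j p p′ → stateAt (suc j) (inPrefix p′) ∈ succQ (stateAt j (inPrefix p)) (u (suc j))
    step-in-prefix j p p′ = ∈-succQ-continue s t false (segment hu 0 j) false (u (suc j))
      (cong (λ z → just (s , t , false , z , false)) (segment-suc hu 0 j))

    step-close-prefix : ∀ j p (e : suc j ≡ cuts 0 + 0) r<d →
                        stateAt (suc j) (inBlock 0 0 e r<d) ∈ succQ (stateAt j (inPrefix p)) (u (suc j))
    step-close-prefix j p e r<d = ∈-succQ-close s t false (segment hu 0 j) false (u (suc j))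
      (just-injective (trans (sym (val≡segment hu 0 j)) (trans (cong (val hu 0) (trans e (+-identityʳ c0))) pre)))
      (cong (λ z → just (s , t , true , z , true)) (trans (segment-zero hu c0) (cong hu (sym e))))

    step-in-block : ∀ j k r (e : j ≡ cuts k + r) r<d (e′ : suc j ≡ cuts k + suc r) r′<d →
                    stateAt (suc j) (inBlock k (suc r) e′ r′<d) ∈ succQ (stateAt j (inBlock k r e r<d)) (u (suc j))
    step-in-block j k r e r<d e′ r′<d = ∈-succQ-continue s t true (segment hu (cuts k) r) (isZero r) (u (suc j))
      (cong (λ z → just (s , t , true , z , false))
        (trans (segment-suc hu (cuts k) r) (cong (λ z → segment hu (cuts k) r · hu z) (trans (+-suc (cuts k) r) (cong suc (sym e))))))

    step-close-block : ∀ j k r (e : j ≡ cuts k + r) r<d → suc r ≡ d k → ∀ (e′ : suc j ≡ cuts (suc k) + 0) r′<d →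
                       stateAt (suc j) (inBlock (suc k) 0 e′ r′<d) ∈ succQ (stateAt j (inBlock k r e r<d)) (u (suc j))
    step-close-block j k r e r<d sr≡d e′ r′<d = ∈-succQ-close s t true (segment hu (cuts k) r) (isZero r) (u (suc j))
      (just-injective (trans (sym (val≡segment hu (cuts k) r)) (trans (cong (val hu (cuts k)) sr≡d) (blk k))))
      (cong (λ z → just (s , t , true , z , true)) (trans (segment-zero hu (cuts (suc k))) (cong hu (sym e′))))

    step : ∀ j (l : Location c0 d j) (l′ : Location c0 d (suc j)) → stateAt (suc j) l′ ∈ succQ (stateAt j l) (u (suc j))
    step j (inPrefix p) (inPrefix p′) = step-in-prefix j p p′
    step j (inPrefix p) (inBlock k r e r<d) = prefix-end k r e r<d (block-unique c0 d at-c0 r<d (d>0 0)) r≡0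
      where
      ≤c0 : cuts k + r ≤ c0
      ≤c0 = subst (_≤ c0) e p
      r≡0 : r ≡ 0
      r≡0 = n≤0⇒n≡0 (+-cancelˡ-≤ (cuts k) r 0 (≤-trans ≤c0 (≤-trans (c0≤cut c0 d k) (≤-reflexive (sym (+-identityʳ (cuts k)))))))
      at-c0 : cuts k + r ≡ c0 + 0
      at-c0 = ≤-antisym (≤-trans ≤c0 (≤-reflexive (sym (+-identityʳ c0))))
                        (≤-trans (≤-reflexive (+-identityʳ c0)) (≤-trans (c0≤cut c0 d k) (m≤m+n (cuts k) r)))
      prefix-end : ∀ k r (e : suc j ≡ cuts k + r) r<d → k ≡ 0 → r ≡ 0 →
                   stateAt (suc j) (inBlock k r e r<d) ∈ succQ (stateAt j (inPrefix p)) (u (suc j))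
      prefix-end .0 .0 e r<d refl refl = step-close-prefix j p e r<d
    step j (inBlock k r e r<d) (inPrefix p′) = ⊥-elim (prefix-disjoint-block c0 d k r (≤-trans (n≤1+n _) p′) e)
    step j (inBlock k r e r<d) (inBlock k′ r′ e′ r′<d) with suc r <? d k
    ... | yes sr<d = same-block k′ r′ e′ r′<d (block-unique c0 d e″ sr<d r′<d)
      where
      e″ : cuts k + suc r ≡ cuts k′ + r′
      e″ = trans (sym (trans (cong suc e) (sym (+-suc (cuts k) r)))) e′
      same-block : ∀ k′ r′ (e′ : suc j ≡ cuts k′ + r′) r′<d → k ≡ k′ →
                   stateAt (suc j) (inBlock k′ r′ e′ r′<d) ∈ succQ (stateAt j (inBlock k r e r<d)) (u (suc j))
      same-block .k r′ e′ r′<d refl with +-cancelˡ-≡ (cuts k) r′ (suc r) (trans (sym e′) (trans (cong suc e) (sym (+-suc (cuts k) r))))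
      ... | refl = step-in-block j k r e r<d e′ r′<d
    ... | no sr≮d = next-block k′ r′ e′ r′<d (block-unique c0 d e″ (d>0 (suc k)) r′<d)
      where
      sr≡d : suc r ≡ d k
      sr≡d = ≤-antisym r<d (≮⇒≥ sr≮d)
      at-next-cut : suc j ≡ cuts (suc k) + 0
      at-next-cut = sym (trans (+-identityʳ _) (trans (cong (cuts k +_) (sym sr≡d)) (trans (+-suc (cuts k) r) (cong suc (sym e)))))
      e″ : cuts (suc k) + 0 ≡ cuts k′ + r′
      e″ = trans (sym at-next-cut) e′
      next-block : ∀ k′ r′ (e′ : suc j ≡ cuts k′ + r′) r′<d → suc k ≡ k′ →
                   stateAt (suc j) (inBlock k′ r′ e′ r′<d) ∈ succQ (stateAt j (inBlock k r e r<d)) (u (suc j))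
      next-block .(suc k) r′ e′ r′<d refl with +-cancelˡ-≡ (cuts (suc k)) r′ 0 (trans (sym e′) at-next-cut)
      ... | refl = step-close-block j k r e r<d sr≡d e′ r′<d

    fresh-at-cut : ∀ i (l : Location c0 d (cuts i)) → accQ (stateAt (cuts i) l) ≡ true
    fresh-at-cut i (inPrefix p) = ⊥-elim (prefix-disjoint-block c0 d i 0 p (sym (+-identityʳ _)))
    fresh-at-cut i (inBlock k r e rl) = at-cut k r e rl (block-unique c0 d (trans (sym e) (sym (+-identityʳ (cuts i)))) rl (d>0 i))
      where
      at-cut : ∀ k r (e : cuts i ≡ cuts k + r) (rl : r < d k) → k ≡ i → accQ (stateAt (cuts i) (inBlock k r e rl)) ≡ true
      at-cut .i r e rl refl with +-cancelˡ-≡ (cuts i) r 0 (trans (sym e) (sym (+-identityʳ (cuts i))))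
      ... | refl = refl

    accepting-run : AcceptsLA automaton u
    accepting-run = ρ , refl , steps , infinitelyFresh
      where
      steps : ∀ i → ρ (suc i) ∈ succQ (ρ i) (u i)
      steps zero = step-first (location 0)
      steps (suc j) = step j (location j) (location (suc j))
      infinitelyFresh : ∀ i → Σ ℕ λ j → i ≤ j × accQ (ρ j) ≡ true
      infinitelyFresh i = suc (cuts i) , ≤-trans (k≤cut c0 d d>0 i) (n≤1+n _) , fresh-at-cut i (location (cuts i))

  -- The fresh positions of an accepting run cut the word along the pair (s, t) guessed first.
  module FactorisationOfRun {A : Set} (R : Recognizer A) (u : ℕ → A) (ρ : ℕ → Maybe (Automaton.State R)) (ρ0 : ρ 0 ≡ nothing)
             (run-step : ∀ i → ρ (suc i) ∈ Automaton.succQ R (ρ i) (u i))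
             (run-fresh : ∀ i → Σ ℕ λ j → i ≤ j × Automaton.accQ R (ρ j) ≡ true) where
    open Recognizer R
    open Factorisation sg
    open Automaton R

    hu : ℕ → T
    hu = h ∘ u

    σ : ℕ → Maybe State
    σ i = ρ (suc i)

    firstStep : Σ T λ s → Σ T λ t → Linked s t × good s t ≡ true × σ 0 ≡ just (s , t , false , hu 0 , false)
    firstStep = succQ-start-elim (u 0) (subst (λ z → σ 0 ∈ succQ z (u 0)) ρ0 (run-step 0))

    s : T
    s = proj₁ firstStep
    t : T
    t = proj₁ (proj₂ firstStep)
    linked : Linked s t
    linked = proj₁ (proj₂ (proj₂ firstStep))
    isGood : good s t ≡ true
    isGood = proj₁ (proj₂ (proj₂ (proj₂ firstStep)))
    σ-first : σ 0 ≡ just (s , t , false , hu 0 , false)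
    σ-first = proj₂ (proj₂ (proj₂ (proj₂ firstStep)))

    σ-step : ∀ j ph x f → σ j ≡ just (s , t , ph , x , f) →
            (σ (suc j) ≡ just (s , t , ph , x · hu (suc j) , false)) ⊎ ((x ≡ segmentTarget ph s t) × (σ (suc j) ≡ just (s , t , true , hu (suc j) , true)))
    σ-step j ph x f e = succQ-step-elim s t ph x f (u (suc j)) (subst (λ z → σ (suc j) ∈ succQ z (u (suc j))) e (run-step (suc j)))

    σ-shape : ∀ j → Σ Bool λ ph → Σ T λ x → Σ Bool λ f → σ j ≡ just (s , t , ph , x , f)
    σ-shape zero = false , hu 0 , false , σ-first
    σ-shape (suc j) with σ-shape j
    ... | ph , x , f , e with σ-step j ph x f e
    ... | inj₁ e' = ph , _ , false , e'
    ... | inj₂ (_ , e') = true , hu (suc j) , true , e'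

    fresh : ℕ → Bool
    fresh i = accQ (σ i)

    infinitelyFresh : ∀ i → Σ ℕ λ j → i ≤ j × fresh j ≡ true
    infinitelyFresh i with run-fresh (suc i)
    ... | suc j , s≤s ij , a = j , ij , a

    open NextTrue fresh infinitelyFresh

    boundary : ℕ → ℕ
    boundary zero = nextTrue 0
    boundary (suc k) = nextTrue (suc (boundary k))

    boundary-increasing : ∀ k → boundary k < boundary (suc k)
    boundary-increasing k = proj₁ (nextTrue-first (suc (boundary k)))

    boundary-fresh : ∀ k → fresh (boundary k) ≡ true
    boundary-fresh zero = proj₁ (proj₂ (nextTrue-first 0))
    boundary-fresh (suc k) = proj₁ (proj₂ (nextTrue-first (suc (boundary k))))

    not-fresh : ∀ j ph x → σ j ≡ just (s , t , ph , x , false) → fresh j ≡ true → ⊥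
    not-fresh j ph x e f rewrite e = false≢true f

    fresh⇒closed : ∀ j ph x f → σ j ≡ just (s , t , ph , x , f) → fresh (suc j) ≡ true →
              (x ≡ segmentTarget ph s t) × (σ (suc j) ≡ just (s , t , true , hu (suc j) , true))
    fresh⇒closed j ph x f e fs with σ-step j ph x f e
    ... | inj₁ e' = ⊥-elim (not-fresh (suc j) ph _ e' fs)
    ... | inj₂ r = r

    σ-inPrefix : ∀ i → i < boundary 0 → σ i ≡ just (s , t , false , segment hu 0 i , false)
    σ-inPrefix zero _ = trans σ-first (cong (λ z → just (s , t , false , z , false)) (sym (segment-zero hu 0)))
    σ-inPrefix (suc i) si<boundary with σ-step i false (segment hu 0 i) false (σ-inPrefix i (≤-trans (n≤1+n _) si<boundary))
    ... | inj₁ e = trans e (cong (λ z → just (s , t , false , z , false)) (sym (segment-suc hu 0 i)))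
    ... | inj₂ (_ , e) = ⊥-elim (isFresh e)
      where
      isFresh : σ (suc i) ≡ just (s , t , true , hu (suc i) , true) → ⊥
      isFresh e' with trans (sym (proj₂ (proj₂ (nextTrue-first 0)) (suc i) z≤n si<boundary)) (cong accQ e')
      ... | ()

    boundary₀-positive : Σ ℕ λ p → boundary 0 ≡ suc p
    boundary₀-positive with boundary 0 in eq
    ... | suc p = p , refl
    ... | zero = ⊥-elim (not-fresh 0 false (hu 0) σ-first (subst (λ z → fresh z ≡ true) eq (boundary-fresh 0)))

    prefixVal : val hu 0 (boundary 0) ≡ just s
    prefixVal with boundary₀-positive
    ... | p , e = trans (cong (val hu 0) e) (trans (val≡segment hu 0 p) (cong just segment≡s))
      where
      segment≡s : segment hu 0 p ≡ s
      segment≡s = proj₁ (fresh⇒closed p false (segment hu 0 p) false (σ-inPrefix p (subst (p <_) (sym e) (n<1+n p))) (subst (λ z → fresh z ≡ true) e (boundary-fresh 0)))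

    boundary-positive : ∀ k → Σ ℕ λ p → boundary k ≡ suc p
    boundary-positive zero = boundary₀-positive
    boundary-positive (suc k) with boundary (suc k) | boundary-increasing k
    ... | suc p | _ = p , refl

    σ-inBlock : ∀ k r → boundary k + r < boundary (suc k) → Σ Bool λ f → σ (boundary k + r) ≡ just (s , t , true , segment hu (boundary k) r , f)
    σ-inBlock k zero _ with boundary-positive k
    ... | p , e with σ-shape p
    ... | ph , x , f , es = true , trans (cong σ (trans (+-identityʳ (boundary k)) e))
            (trans (proj₂ (fresh⇒closed p ph x f es (subst (λ z → fresh z ≡ true) e (boundary-fresh k))))
              (cong (λ z → just (s , t , true , z , true)) (trans (cong hu (sym (trans (+-identityʳ (boundary k)) e))) (sym (segment-zero hu (boundary k))))))
    σ-inBlock k (suc r) lt with σ-inBlock k r (≤-trans (n≤1+n _) (subst (_< boundary (suc k)) (+-suc (boundary k) r) lt))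
    ... | f , e with σ-step (boundary k + r) true (segment hu (boundary k) r) f e
    ... | inj₁ e' = false , trans (cong σ (+-suc (boundary k) r))
            (trans e' (cong (λ z → just (s , t , true , z , false)) (trans (cong (λ z → segment hu (boundary k) r · hu z) (sym (+-suc (boundary k) r))) (sym (segment-suc hu (boundary k) r)))))
    ... | inj₂ (_ , e') = ⊥-elim (not-fresh-inside (trans (cong fresh (+-suc (boundary k) r)) (cong accQ e')))
      where
      not-fresh-inside : fresh (boundary k + suc r) ≡ true → ⊥
      not-fresh-inside x with trans (sym (proj₂ (proj₂ (nextTrue-first (suc (boundary k)))) (boundary k + suc r) (subst (suc (boundary k) ≤_) (sym (+-suc (boundary k) r)) (s≤s (m≤m+n (boundary k) r))) lt)) x
      ... | ()

    blockVal : ∀ k → val hu (boundary k) (boundary (suc k) ∸ boundary k) ≡ just t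
    blockVal k with boundary-positive (suc k)
    ... | p , e = trans (cong (val hu (boundary k)) length≡suc-r) (trans (val≡segment hu (boundary k) r) (cong just segment≡t))
      where
      bk≤p : boundary k ≤ p
      bk≤p with boundary-increasing k
      ... | lt = ≤-pred (subst (boundary k <_) e lt)
      r : ℕ
      r = p ∸ boundary k
      bk+r≡p : boundary k + r ≡ p
      bk+r≡p = m+[n∸m]≡n bk≤p
      length≡suc-r : boundary (suc k) ∸ boundary k ≡ suc r
      length≡suc-r = trans (cong (_∸ boundary k) (trans e (cong suc (sym bk+r≡p)))) (trans (cong (_∸ boundary k) (sym (+-suc (boundary k) r))) (m+n∸m≡n (boundary k) (suc r)))
      σ-end = σ-inBlock k r (subst (_< boundary (suc k)) (sym bk+r≡p) (subst (p <_) (sym e) (n<1+n p)))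
      segment≡t : segment hu (boundary k) r ≡ t
      segment≡t = proj₁ (fresh⇒closed (boundary k + r) true (segment hu (boundary k) r) (proj₁ σ-end) (proj₂ σ-end) (subst (λ z → fresh z ≡ true) (trans e (cong suc (sym bk+r≡p))) (boundary-fresh (suc k))))

    factorisation : Factorises hu s t
    factorisation = factorises-fromCuts hu boundary t boundary-increasing blockVal s prefixVal

  module _ (em : ExcludedMiddle) {A : Set} (R : Recognizer A) (L : (ℕ → A) → Set) (R-L : Recognizes R L) where
    open Automaton R

    automaton-recognizes : ∀ u → L u ⇔ AcceptsLA automaton u
    automaton-recognizes u = mk⇔ member⇒accepted accepted⇒member
      where
      open Recognizer R
      open Factorisation sg
      member⇒accepted : L u → AcceptsLA automaton u
      member⇒accepted l = fromFactorisation (factorise em (h ∘ u))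
        where
        fromFactorisation : (Σ T λ s → Σ T λ t → Linked s t × Factorises (h ∘ u) s t) → AcceptsLA automaton u
        fromFactorisation (s , t , linked , f) = RunOfFactorisation.accepting-run R u s t linked (to (R-L u s t linked f) l) f
      accepted⇒member : AcceptsLA automaton u → L u
      accepted⇒member (ρ , ρ0 , run-step , run-fresh) = from (R-L u s t linked factorisation) isGood
        where open FactorisationOfRun R u ρ ρ0 run-step run-fresh



module TypeAlphabet where

  open import Data.Nat using (ℕ; zero; suc)
  open import Data.Fin using (Fin; zero; suc)
  open import Data.Bool using (Bool; true; false)
  open import Data.Vec using (Vec; []; _∷_; lookup)
  open import Data.Vec.Properties using (∷-injective)
  open import Data.Product using (Σ; _×_; _,_; proj₁; proj₂)
  open import Data.Empty using (⊥-elim)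
  open import Data.List using (List; map; concatMap)
  open import Data.List.Membership.Propositional using (_∈_)
  open import Data.List.Membership.Propositional.Properties using (∈-map⁺; ∈-map⁻)
  open import Function using (_∘_; case_of_)
  open import Function.Bundles using (_⇔_; mk⇔; Equivalence)
  open import Relation.Binary.PropositionalEquality
  open import Relation.Nullary using (yes; no)
  open import Relation.Nullary.Decidable using (isYes)
  open import Defs
  open Finiteness
  open ListAutomata
  open Equivalence

  module _ {𝓜 : Structure} (𝓛 : Logic 𝓜) (n : ℕ) where
    open Structure 𝓜
    open Logic 𝓛

    typeFormula : ∀ {m} → (Fin m → Form n) → Vec Bool m → Form n
    typeFormula Φ [] = ⊤′
    typeFormula Φ (true ∷ a) = Φ zero ∧′ typeFormula (Φ ∘ suc) a
    typeFormula Φ (false ∷ a) = (¬′ Φ zero) ∧′ typeFormula (Φ ∘ suc) a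

    module _ (em : ExcludedMiddle) where

      typeOf : ∀ {m} → (Fin m → Form n) → (Fin n → Dom) → Vec Bool m
      typeOf {zero} Φ x = []
      typeOf {suc m} Φ x = isYes (em (x ⊨ Φ zero)) ∷ typeOf (Φ ∘ suc) x

      ⊨typeFormula⇔ : ∀ {m} (Φ : Fin m → Form n) x a → (x ⊨ typeFormula Φ a) ⇔ (a ≡ typeOf Φ x)
      ⊨typeFormula⇔ {zero} Φ x [] = mk⇔ (λ _ → refl) (λ _ → ⊨⊤′ x)
      ⊨typeFormula⇔ {suc m} Φ x (true ∷ a) with em (x ⊨ Φ zero)
      ... | yes p = mk⇔ (λ q → cong (true ∷_) (to (⊨typeFormula⇔ (Φ ∘ suc) x a) (proj₂ (to (⊨∧′ x _ _) q))))
                        (λ e → from (⊨∧′ x _ _) (p , from (⊨typeFormula⇔ (Φ ∘ suc) x a) (proj₂ (∷-injective e))))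
      ... | no ¬p = mk⇔ (λ q → ⊥-elim (¬p (proj₁ (to (⊨∧′ x _ _) q)))) (λ e → case proj₁ (∷-injective e) of λ ())
      ⊨typeFormula⇔ {suc m} Φ x (false ∷ a) with em (x ⊨ Φ zero)
      ... | no ¬p = mk⇔ (λ q → cong (false ∷_) (to (⊨typeFormula⇔ (Φ ∘ suc) x a) (proj₂ (to (⊨∧′ x _ _) q))))
                        (λ e → from (⊨∧′ x _ _) (from (⊨¬′ x _) ¬p , from (⊨typeFormula⇔ (Φ ∘ suc) x a) (proj₂ (∷-injective e))))
      ... | yes p = mk⇔ (λ q → ⊥-elim (to (⊨¬′ x _) (proj₁ (to (⊨∧′ x _ _) q)) p)) (λ e → case proj₁ (∷-injective e) of λ ())

      lookup-typeOf : ∀ {m} (Φ : Fin m → Form n) x k → (lookup (typeOf Φ x) k ≡ true) ⇔ (x ⊨ Φ k)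
      lookup-typeOf {suc m} Φ x zero with em (x ⊨ Φ zero)
      ... | yes p = mk⇔ (λ _ → p) (λ _ → refl)
      ... | no ¬p = mk⇔ (λ ()) (λ p → ⊥-elim (¬p p))
      lookup-typeOf {suc m} Φ x (suc k) = lookup-typeOf (Φ ∘ suc) x k

    module _ {m : ℕ} (Φ : Fin m → Form n) (M : ListAutomaton (Vec Bool m)) where
      open ListAutomaton M

      allTypes : List (Vec Bool m)
      allTypes = enumerate (Vec-finite Bool-finite m)

      transitions : List (Fin (size finQ) × Form n × Fin (size finQ))
      transitions = concatMap (λ q → concatMap (λ a → map (λ q′ → (indexOf finQ q , typeFormula Φ a , indexOf finQ q′)) (succ q a)) allTypes) (enumerate finQ)

      toBüchi : Büchi 𝓛 n
      toBüchi = record { nQ = size finQ ; q₀ = indexOf finQ q0 ; Δ = transitions ; acc = λ i → acc (elementAt finQ i) }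

      triple-injective : ∀ {A B C : Set} {a a′ : A} {b b′ : B} {c c′ : C} → (a , b , c) ≡ (a′ , b′ , c′) → (a ≡ a′) × (b ≡ b′) × (c ≡ c′)
      triple-injective refl = refl , refl , refl

      toBüchi-correct : (em : ExcludedMiddle) → ∀ w → AcceptedBy 𝓛 toBüchi w ⇔ AcceptsLA M (λ i → typeOf em Φ (w i))
      toBüchi-correct em w = mk⇔ büchi⇒ ⇒büchi
        where
        büchi⇒ : AcceptedBy 𝓛 toBüchi w → AcceptsLA M (λ i → typeOf em Φ (w i))
        büchi⇒ (ρ , (ρ0 , trans-ρ) , infinitelyAcc) =
          elementAt finQ ∘ ρ , trans (cong (elementAt finQ) ρ0) (elementAt-indexOf finQ q0) , step , infinitelyAcc
          where
          step : ∀ i → elementAt finQ (ρ (suc i)) ∈ succ (elementAt finQ (ρ i)) (typeOf em Φ (w i))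
          step i with trans-ρ i
          ... | φ , δ∈ , sat with ∈-concatMap-elim _ (enumerate finQ) δ∈
          ... | q , δ∈q with ∈-concatMap-elim _ allTypes δ∈q
          ... | a , δ∈qa with ∈-map⁻ _ δ∈qa
          ... | q′ , q′∈ , eq with triple-injective eq
          ... | e₁ , e₂ , e₃ =
            subst₂ (λ x y → x ∈ succ y (typeOf em Φ (w i)))
              (sym (trans (cong (elementAt finQ) e₃) (elementAt-indexOf finQ q′)))
              (sym (trans (cong (elementAt finQ) e₁) (elementAt-indexOf finQ q)))
              (subst (λ z → q′ ∈ succ q z) (to (⊨typeFormula⇔ em Φ (w i) a) (subst (w i ⊨_) e₂ sat)) q′∈)
        ⇒büchi : AcceptsLA M (λ i → typeOf em Φ (w i)) → AcceptedBy 𝓛 toBüchi w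
        ⇒büchi (ρ , ρ0 , step , infinitelyAcc) = indexOf finQ ∘ ρ , (cong (indexOf finQ) ρ0 , transition) ,
          λ i → let (j , i≤j , a) = infinitelyAcc i in j , i≤j , trans (cong acc (elementAt-indexOf finQ (ρ j))) a
          where
          transition : ∀ i → Σ (Form n) λ φ → ((indexOf finQ (ρ i) , φ , indexOf finQ (ρ (suc i))) ∈ transitions) × (w i ⊨ φ)
          transition i = typeFormula Φ (typeOf em Φ (w i)) ,
            ∈-concatMap-intro _ (∈-enumerate finQ (ρ i)) (∈-concatMap-intro _ (∈-enumerate (Vec-finite Bool-finite m) (typeOf em Φ (w i))) (∈-map⁺ _ (step i))) ,
            from (⊨typeFormula⇔ em Φ (w i) (typeOf em Φ (w i))) refl


module AtomSemantics where

  open import Data.Nat using (ℕ; zero; suc; _<_; s≤s)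
  open import Data.Nat.Properties using (m≤n⇒m<n∨m≡n; n<1+n; m<n⇒m<1+n)
  open import Data.Fin using (Fin)
  open import Data.Bool using (Bool; true; false)
  open import Data.Vec using (lookup)
  open import Data.Product using (Σ; _×_; _,_; proj₁; proj₂)
  open import Data.Sum using (inj₁; inj₂)
  open import Function using (case_of_)
  open import Function.Bundles using (_⇔_; mk⇔; Equivalence)
  open import Relation.Binary.PropositionalEquality
  open BoolEquations
  open SafetyAutomata
  open SetMSO
  open Equivalence

  setVar : ∀ {m c} → (ℕ → Letter m c) → Fin c → ℕ → Bool
  setVar u j n = lookup (proj₂ (u n)) j

  module _ {m c : ℕ} (u : ℕ → Letter m c) where

    Sub-safe⇔ : ∀ i j → Safe (atomAutomaton (Sub i j)) u ⇔ (∀ n → setVar u i n ≡ true → setVar u j n ≡ true)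
    Sub-safe⇔ i j = mk⇔ (λ safe n → to (⇒ᵇ≡true⇔ _ _) (safe n)) (λ ⊆ n → from (⇒ᵇ≡true⇔ _ _) (⊆ n))

    Emp-safe⇔ : ∀ i → Safe (atomAutomaton (Emp {m} i)) u ⇔ (∀ n → setVar u i n ≡ false)
    Emp-safe⇔ i = mk⇔ (λ safe n → to (not≡true⇔ _) (safe n)) (λ empty n → from (not≡true⇔ _) (empty n))

    Pk-safe⇔ : ∀ k i → Safe (atomAutomaton (Pk k i)) u ⇔ (∀ n → setVar u i n ≡ true → lookup (proj₁ (u n)) k ≡ true)
    Pk-safe⇔ k i = mk⇔ (λ safe n → to (⇒ᵇ≡true⇔ _ _) (safe n)) (λ ⊆ n → from (⇒ᵇ≡true⇔ _ _) (⊆ n))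

    Zero-safe⇔ : ∀ i → Safe (atomAutomaton (Zero {m} i)) u ⇔ (∀ n → (setVar u i n ≡ true) ⇔ (n ≡ 0))
    Zero-safe⇔ i = mk⇔ safe⇒ ⇒safe
      where
      safe⇒ : _
      safe⇒ safe zero = mk⇔ (λ _ → refl) (λ _ → to (iffᵇ≡true⇔ _ _) (safe zero))
      safe⇒ safe (suc n) = mk⇔ (λ e → case trans (sym e) (to (iffᵇ≡true⇔ _ _) (safe (suc n))) of λ ()) (λ ())
      ⇒safe : _
      ⇒safe only0 zero = from (iffᵇ≡true⇔ _ _) (from (only0 zero) refl)
      ⇒safe only0 (suc n) = from (iffᵇ≡true⇔ _ _) (absent (setVar u i (suc n)) refl)
        where
        absent : ∀ b → setVar u i (suc n) ≡ b → b ≡ false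
        absent true e = case to (only0 (suc n)) e of λ ()
        absent false _ = refl

    Succ-safe⇔ : ∀ i j → Safe (atomAutomaton (Succ {m} i j)) u ⇔ ((setVar u j 0 ≡ false) × (∀ n → setVar u j (suc n) ≡ setVar u i n))
    Succ-safe⇔ i j = mk⇔ (λ safe → to (iffᵇ≡true⇔ _ _) (safe zero) , λ n → to (iffᵇ≡true⇔ _ _) (safe (suc n)))
                         (λ { (z , f) zero → from (iffᵇ≡true⇔ _ _) z ; (z , f) (suc n) → from (iffᵇ≡true⇔ _ _) (f n) })

    -- The state of the Less automaton records whether X i has been met strictly before.
    Less-state⇔ : ∀ i j n → (state (atomAutomaton (Less i j)) u n ≡ true) ⇔ (Σ ℕ λ k → k < n × setVar u i k ≡ true)
    Less-state⇔ i j zero = mk⇔ (λ ()) (λ { (k , () , _) })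
    Less-state⇔ i j (suc n) = mk⇔
      (λ e → case to (∨≡true⇔ _ _) e of λ where
        (inj₁ before) → let (k , k<n , xk) = to (Less-state⇔ i j n) before in k , m<n⇒m<1+n k<n , xk
        (inj₂ now) → n , n<1+n n , now)
      (λ where
        (k , s≤s k≤n , xk) → from (∨≡true⇔ _ _) (case m≤n⇒m<n∨m≡n k≤n of λ where
          (inj₁ k<n) → inj₁ (from (Less-state⇔ i j n) (k , k<n , xk))
          (inj₂ refl) → inj₂ xk))

    Less-safe⇔ : ∀ i j → Safe (atomAutomaton (Less i j)) u ⇔ (∀ n → setVar u j n ≡ true → Σ ℕ λ k → k < n × setVar u i k ≡ true)
    Less-safe⇔ i j = mk⇔ (λ safe n xj → to (Less-state⇔ i j n) (to (⇒ᵇ≡true⇔ _ _) (safe n) xj))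
                         (λ f n → from (⇒ᵇ≡true⇔ _ _) (λ xj → from (Less-state⇔ i j n) (f n xj)))


module EliminateFirstOrder where

  open import Data.Nat using (ℕ; zero; suc; _<_; _≟_)
  open import Data.Nat.Properties using (suc-injective)
  open import Data.Fin using (Fin; zero; suc)
  open import Data.Bool using (Bool; true; false)
  open import Data.Vec using (lookup)
  open import Data.Product using (Σ; _×_; _,_; proj₁; proj₂)
  open import Data.Empty using (⊥-elim)
  open import Function.Bundles using (_⇔_; mk⇔; Equivalence)
  open import Relation.Binary.PropositionalEquality
  open import Relation.Nullary using (¬_)
  open import Relation.Nullary.Decidable using (isYes)
  open import Defs
  open BoolEquations
  open SetMSO
  open AtomSemantics
  open Equivalence

  liftVar : ∀ {a c} → (Fin a → Fin c) → Fin (suc a) → Fin (suc c)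
  liftVar f zero = zero
  liftVar f (suc x) = suc (f x)

  singleton : ℕ → ℕ → Bool
  singleton p k = isYes (k ≟ p)

  singleton≡true⇔ : ∀ p k → (singleton p k ≡ true) ⇔ (k ≡ p)
  singleton≡true⇔ p k = isYes≡true⇔ (k ≟ p)

  IsSingleton : ∀ {m c} → (ℕ → Letter m c) → Fin c → ℕ → Set
  IsSingleton u j p = ∀ k → (setVar u j k ≡ true) ⇔ (k ≡ p)

  nonemptyProperSubset : ∀ {m c} → Fin c → SetFormula m (suc c)
  nonemptyProperSubset j = and (atom (Sub zero (suc j))) (and (neg (atom (Emp zero))) (neg (atom (Sub (suc j) zero))))

  -- A set is a singleton iff it is nonempty and has no nonempty proper subset.
  singletonF : ∀ {m c} → Fin c → SetFormula m c
  singletonF j = and (neg (atom (Emp j))) (neg (ex (nonemptyProperSubset j)))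

  module _ (em : ExcludedMiddle) where
    open Classical em

    singletonF⇔ : ∀ {m c} (u : ℕ → Letter m c) j → SatSet (singletonF j) u ⇔ (Σ ℕ λ p → IsSingleton u j p)
    singletonF⇔ {m} u j = mk⇔ F⇒singleton singleton⇒F
      where
      F⇒singleton : SatSet (singletonF j) u → Σ ℕ λ p → IsSingleton u j p
      F⇒singleton (¬empty , noProperSubset) = p , single
        where
        element : Σ ℕ λ p → setVar u j p ≡ true
        element = ¬¬-elim λ none → ¬empty (from (Emp-safe⇔ u j) λ k → all-false none k)
          where
          all-false : ¬ (Σ ℕ λ p → setVar u j p ≡ true) → ∀ k → setVar u j k ≡ false
          all-false none k with setVar u j k in eq
          ... | true = ⊥-elim (none (k , eq))
          ... | false = refl
        p = proj₁ element
        Y = singleton p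
        ⊆singleton : ∀ k → setVar u j k ≡ true → singleton p k ≡ true
        ⊆singleton k k∈X = ¬¬-elim λ ¬Y → noProperSubset (Y , from (Sub-safe⇔ (cons u Y) zero (suc j)) (λ k' k∈Y → subst (λ z → setVar u j z ≡ true) (sym (to (singleton≡true⇔ p k') k∈Y)) (proj₂ element))
                     , (λ Y-empty → false≢true (trans (sym (to (Emp-safe⇔ (cons u Y) zero) Y-empty p)) (from (singleton≡true⇔ p p) refl)))
                     , λ s → ¬Y (to (Sub-safe⇔ (cons u Y) (suc j) zero) s k k∈X))
        single : IsSingleton u j p
        single k = mk⇔ (λ k∈X → to (singleton≡true⇔ p k) (⊆singleton k k∈X)) (λ e → subst (λ z → setVar u j z ≡ true) (sym e) (proj₂ element))
      singleton⇒F : (Σ ℕ λ p → IsSingleton u j p) → SatSet (singletonF j) u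
      singleton⇒F (p , single) = (λ e → false≢true (trans (sym (to (Emp-safe⇔ u j) e p)) (from (single p) refl))) , noProperSubset
        where
        noProperSubset : ¬ SatSet (ex (nonemptyProperSubset j)) u
        noProperSubset (Y , Y⊆X , ¬empty , X⊈Y) = X⊈Y (from (Sub-safe⇔ (cons u Y) (suc j) zero) λ k k∈X → subst (λ z → Y z ≡ true) (sym (to (single k) k∈X)) p∈Y)
          where
          p∈Y : Y p ≡ true
          p∈Y with Y p in eq
          ... | true = refl
          ... | false = ⊥-elim (¬empty (from (Emp-safe⇔ (cons u Y) zero) λ k → all-false k))
            where
            all-false : ∀ k → Y k ≡ false
            all-false k with Y k in eq2
            ... | false = refl
            ... | true = ⊥-elim (false≢true (trans (sym eq) (subst (λ z → Y z ≡ true) (to (single k) (to (Sub-safe⇔ (cons u Y) zero (suc j)) Y⊆X k eq2)) eq2)))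

  module _ {𝓜 : Structure} (𝓛 : Logic 𝓜) {n m : ℕ} (Φ : Fin m → Logic.Form 𝓛 n) where
    open Structure 𝓜
    open Logic 𝓛

    translateTerm : ∀ {a c} → Term 𝓛 a → (Fin a → Fin c) → Fin c → SetFormula m c
    translateTerm (var x) ρ j = and (atom (Sub (ρ x) j)) (atom (Sub j (ρ x)))
    translateTerm `0 ρ j = atom (Zero j)
    translateTerm (`S t) ρ j = ex (and (translateTerm t (λ x → suc (ρ x)) zero) (atom (Succ zero (suc j))))

    translateTerm-correct : ∀ {a c} (t : Term 𝓛 a) (ρ : Fin a → Fin c) (σ : Fin a → ℕ) (u : ℕ → Letter m c) j →
              (∀ x → IsSingleton u (ρ x) (σ x)) → SatSet (translateTerm t ρ j) u ⇔ IsSingleton u j (⟦_⟧ₜ 𝓛 t σ)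
    translateTerm-correct (var x) ρ σ u j rep = mk⇔
      (λ (s1 , s2) k → mk⇔ (λ xk → to (rep x k) (to (Sub-safe⇔ u j (ρ x)) s2 k xk)) (λ e → to (Sub-safe⇔ u (ρ x) j) s1 k (from (rep x k) e)))
      (λ single → from (Sub-safe⇔ u (ρ x) j) (λ k xk → from (single k) (to (rep x k) xk)) , from (Sub-safe⇔ u j (ρ x)) (λ k xk → from (rep x k) (to (single k) xk)))
    translateTerm-correct `0 ρ σ u j rep = Zero-safe⇔ u j
    translateTerm-correct (`S t) ρ σ u j rep = mk⇔ formula⇒singleton singleton⇒formula
      where
      p = ⟦_⟧ₜ 𝓛 t σ
      formula⇒singleton : SatSet (translateTerm (`S t) ρ j) u → IsSingleton u j (suc p)
      formula⇒singleton (Z , s1 , s2) zero = mk⇔ (λ x0 → ⊥-elim (false≢true (trans (sym (proj₁ (to (Succ-safe⇔ (cons u Z) zero (suc j)) s2))) x0))) (λ ())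
      formula⇒singleton (Z , s1 , s2) (suc k) = mk⇔
        (λ xk → cong suc (to (to (translateTerm-correct t (λ x → suc (ρ x)) σ (cons u Z) zero rep) s1 k) (trans (sym (proj₂ (to (Succ-safe⇔ (cons u Z) zero (suc j)) s2) k)) xk)))
        (λ e → trans (proj₂ (to (Succ-safe⇔ (cons u Z) zero (suc j)) s2) k) (from (to (translateTerm-correct t (λ x → suc (ρ x)) σ (cons u Z) zero rep) s1 k) (suc-injective e)))
      singleton⇒formula : IsSingleton u j (suc p) → SatSet (translateTerm (`S t) ρ j) u
      singleton⇒formula single = singleton p , from (translateTerm-correct t (λ x → suc (ρ x)) σ (cons u (singleton p)) zero rep) (singleton≡true⇔ p) ,
              from (Succ-safe⇔ (cons u (singleton p)) zero (suc j)) (x0 , λ k → ≡true-ext (λ xk → from (singleton≡true⇔ p k) (suc-injective (to (single (suc k)) xk)))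
                                                                            (λ sk → from (single (suc k)) (cong suc (to (singleton≡true⇔ p k) sk))))
        where
        x0 : setVar u j 0 ≡ false
        x0 with setVar u j 0 in eq
        ... | false = refl
        ... | true with to (single 0) eq
        ... | ()

    -- ρ¹ and ρ² place the first- and second-order variables among the set variables; a first-order
    -- variable is held by a singleton.
    translate : ∀ {a b c} → MSO 𝓛 m a b → (Fin a → Fin c) → (Fin b → Fin c) → SetFormula m c
    translate (s ≐ t) ρ¹ ρ² = ex (ex (and (and (translateTerm s (λ x → suc (suc (ρ¹ x))) (suc zero)) (translateTerm t (λ x → suc (suc (ρ¹ x))) zero)) (and (atom (Sub (suc zero) zero)) (atom (Sub zero (suc zero))))))
    translate (s ≺ t) ρ¹ ρ² = ex (ex (and (and (translateTerm s (λ x → suc (suc (ρ¹ x))) (suc zero)) (translateTerm t (λ x → suc (suc (ρ¹ x))) zero)) (atom (Less (suc zero) zero))))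
    translate (t ∈̇ Y) ρ¹ ρ² = ex (and (translateTerm t (λ x → suc (ρ¹ x)) zero) (atom (Sub zero (suc (ρ² Y)))))
    translate (P k t) ρ¹ ρ² = ex (and (translateTerm t (λ x → suc (ρ¹ x)) zero) (atom (Pk k zero)))
    translate (¬̇ φ) ρ¹ ρ² = neg (translate φ ρ¹ ρ²)
    translate (φ ∧̇ ψ) ρ¹ ρ² = and (translate φ ρ¹ ρ²) (translate ψ ρ¹ ρ²)
    translate (∃¹ φ) ρ¹ ρ² = ex (and (singletonF zero) (translate φ (liftVar ρ¹) (λ x → suc (ρ² x))))
    translate (∃² φ) ρ¹ ρ² = ex (translate φ (λ x → suc (ρ¹ x)) (liftVar ρ²))

    module _ (em : ExcludedMiddle) (w : ℕ → Fin n → Dom) where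

      LettersMatch : ∀ {c} → (ℕ → Letter m c) → Set
      LettersMatch u = ∀ i k → (w i ⊨ Φ k) ⇔ (lookup (proj₁ (u i)) k ≡ true)

      Represents : ∀ {a b c} → (Fin a → Fin c) → (Fin b → Fin c) → (Fin a → ℕ) → (Fin b → ℕ → Bool) → (ℕ → Letter m c) → Set
      Represents ρ¹ ρ² σ τ u = (∀ x → IsSingleton u (ρ¹ x) (σ x)) × (∀ y i → setVar u (ρ² y) i ≡ τ y i)

      represents-ext¹ : ∀ {a c} (ρ¹ : Fin a → Fin c) σ (u : ℕ → Letter m c) x Y → (∀ z → IsSingleton u (ρ¹ z) (σ z)) →
                (∀ k → (Y k ≡ true) ⇔ (k ≡ x)) → ∀ z → IsSingleton (cons u Y) (liftVar ρ¹ z) (ext 𝓛 x σ z)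
      represents-ext¹ ρ¹ σ u x Y rep single zero = single
      represents-ext¹ ρ¹ σ u x Y rep single (suc z) = rep z

      represents-ext² : ∀ {b c} (ρ² : Fin b → Fin c) τ (u : ℕ → Letter m c) Y → (∀ y i → setVar u (ρ² y) i ≡ τ y i) →
                ∀ y i → setVar (cons u Y) (liftVar ρ² y) i ≡ ext 𝓛 Y τ y i
      represents-ext² ρ² τ u Y rep zero i = refl
      represents-ext² ρ² τ u Y rep (suc y) i = rep y i

      ≐-correct : ∀ {a b c} (s t : Term 𝓛 a) (ρ¹ : Fin a → Fin c) (ρ² : Fin b → Fin c) σ τ (u : ℕ → Letter m c) → Represents ρ¹ ρ² σ τ u →
                  Sat 𝓛 w Φ (s ≐ t) σ τ ⇔ SatSet (translate (s ≐ t) ρ¹ ρ²) u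
      ≐-correct s t ρ¹ ρ² σ τ u (rep¹ , rep²) = mk⇔ sat⇒set set⇒sat
        where
        p1 = ⟦_⟧ₜ 𝓛 s σ
        p2 = ⟦_⟧ₜ 𝓛 t σ
        sat⇒set : p1 ≡ p2 → _
        sat⇒set e = singleton p1 , singleton p2 , (from (translateTerm-correct s _ σ u'' (suc zero) rep¹) (singleton≡true⇔ p1) , from (translateTerm-correct t _ σ u'' zero rep¹) (singleton≡true⇔ p2)) ,
               from (Sub-safe⇔ u'' (suc zero) zero) (λ k x → from (singleton≡true⇔ p2 k) (trans (to (singleton≡true⇔ p1 k) x) e)) ,
               from (Sub-safe⇔ u'' zero (suc zero)) (λ k x → from (singleton≡true⇔ p1 k) (trans (to (singleton≡true⇔ p2 k) x) (sym e)))
          where u'' = cons (cons u (singleton p1)) (singleton p2)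
        set⇒sat : SatSet (translate (s ≐ t) ρ¹ ρ²) u → p1 ≡ p2
        set⇒sat (Y1 , Y2 , (S1 , S2) , (sub , _)) = to (is2 p1) (to (Sub-safe⇔ u'' (suc zero) zero) sub p1 (from (is1 p1) refl))
          where
          u'' = cons (cons u Y1) Y2
          is1 = to (translateTerm-correct s _ σ u'' (suc zero) rep¹) S1
          is2 = to (translateTerm-correct t _ σ u'' zero rep¹) S2

      ≺-correct : ∀ {a b c} (s t : Term 𝓛 a) (ρ¹ : Fin a → Fin c) (ρ² : Fin b → Fin c) σ τ (u : ℕ → Letter m c) → Represents ρ¹ ρ² σ τ u →
                  Sat 𝓛 w Φ (s ≺ t) σ τ ⇔ SatSet (translate (s ≺ t) ρ¹ ρ²) u
      ≺-correct s t ρ¹ ρ² σ τ u (rep¹ , rep²) = mk⇔ sat⇒set set⇒sat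
        where
        p1 = ⟦_⟧ₜ 𝓛 s σ
        p2 = ⟦_⟧ₜ 𝓛 t σ
        sat⇒set : p1 < p2 → _
        sat⇒set lt = singleton p1 , singleton p2 , (from (translateTerm-correct s _ σ u'' (suc zero) rep¹) (singleton≡true⇔ p1) , from (translateTerm-correct t _ σ u'' zero rep¹) (singleton≡true⇔ p2)) ,
               from (Less-safe⇔ u'' (suc zero) zero) (λ k x → p1 , subst (p1 <_) (sym (to (singleton≡true⇔ p2 k) x)) lt , from (singleton≡true⇔ p1 p1) refl)
          where u'' = cons (cons u (singleton p1)) (singleton p2)
        set⇒sat : SatSet (translate (s ≺ t) ρ¹ ρ²) u → p1 < p2
        set⇒sat (Y1 , Y2 , (S1 , S2) , less) with to (Less-safe⇔ u'' (suc zero) zero) less p2 (from (is2 p2) refl)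
          where
          u'' = cons (cons u Y1) Y2
          is2 = to (translateTerm-correct t _ σ u'' zero rep¹) S2
        ... | j , j<p2 , yj = subst (_< p2) (to (is1 j) yj) j<p2
          where
          u'' = cons (cons u Y1) Y2
          is1 = to (translateTerm-correct s _ σ u'' (suc zero) rep¹) S1

      ∈̇-correct : ∀ {a b c} (t : Term 𝓛 a) (Y : Fin b) (ρ¹ : Fin a → Fin c) (ρ² : Fin b → Fin c) σ τ (u : ℕ → Letter m c) → Represents ρ¹ ρ² σ τ u →
                   Sat 𝓛 w Φ (t ∈̇ Y) σ τ ⇔ SatSet (translate (t ∈̇ Y) ρ¹ ρ²) u
      ∈̇-correct t Y ρ¹ ρ² σ τ u (rep¹ , rep²) = mk⇔ sat⇒set set⇒sat
        where
        p = ⟦_⟧ₜ 𝓛 t σ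
        sat⇒set : τ Y p ≡ true → _
        sat⇒set e = singleton p , from (translateTerm-correct t _ σ (cons u (singleton p)) zero rep¹) (singleton≡true⇔ p) ,
               from (Sub-safe⇔ (cons u (singleton p)) zero (suc (ρ² Y))) (λ k x → trans (rep² Y k) (subst (λ z → τ Y z ≡ true) (sym (to (singleton≡true⇔ p k) x)) e))
        set⇒sat : SatSet (translate (t ∈̇ Y) ρ¹ ρ²) u → τ Y p ≡ true
        set⇒sat (Z , S1 , sub) = trans (sym (rep² Y p)) (to (Sub-safe⇔ (cons u Z) zero (suc (ρ² Y))) sub p (from (to (translateTerm-correct t _ σ (cons u Z) zero rep¹) S1 p) refl))

      P-correct : ∀ {a b c} (k : Fin m) (t : Term 𝓛 a) (ρ¹ : Fin a → Fin c) (ρ² : Fin b → Fin c) σ τ (u : ℕ → Letter m c) → LettersMatch u → Represents ρ¹ ρ² σ τ u →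
                  Sat 𝓛 w Φ (P k t) σ τ ⇔ SatSet (translate (P k t) ρ¹ ρ²) u
      P-correct k t ρ¹ ρ² σ τ u letters (rep¹ , rep²) = mk⇔ sat⇒set set⇒sat
        where
        p = ⟦_⟧ₜ 𝓛 t σ
        sat⇒set : w p ⊨ Φ k → _
        sat⇒set e = singleton p , from (translateTerm-correct t _ σ (cons u (singleton p)) zero rep¹) (singleton≡true⇔ p) ,
               from (Pk-safe⇔ (cons u (singleton p)) k zero) (λ j x → subst (λ z → lookup (proj₁ (u z)) k ≡ true) (sym (to (singleton≡true⇔ p j) x)) (to (letters p k) e))
        set⇒sat : SatSet (translate (P k t) ρ¹ ρ²) u → w p ⊨ Φ k
        set⇒sat (Z , S1 , pk) = from (letters p k) (to (Pk-safe⇔ (cons u Z) k zero) pk p (from (to (translateTerm-correct t _ σ (cons u Z) zero rep¹) S1 p) refl))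

      translate-correct : ∀ {a b c} (φ : MSO 𝓛 m a b) ρ¹ ρ² σ τ (u : ℕ → Letter m c) → LettersMatch u → Represents ρ¹ ρ² σ τ u →
            Sat 𝓛 w Φ φ σ τ ⇔ SatSet (translate φ ρ¹ ρ²) u
      translate-correct (s ≐ t) ρ¹ ρ² σ τ u letters rep = ≐-correct s t ρ¹ ρ² σ τ u rep
      translate-correct (s ≺ t) ρ¹ ρ² σ τ u letters rep = ≺-correct s t ρ¹ ρ² σ τ u rep
      translate-correct (t ∈̇ Y) ρ¹ ρ² σ τ u letters rep = ∈̇-correct t Y ρ¹ ρ² σ τ u rep
      translate-correct (P k t) ρ¹ ρ² σ τ u letters rep = P-correct k t ρ¹ ρ² σ τ u letters rep
      translate-correct (¬̇ φ) ρ¹ ρ² σ τ u letters rep = mk⇔ (λ ns s0 → ns (from (translate-correct φ ρ¹ ρ² σ τ u letters rep) s0)) (λ ns s → ns (to (translate-correct φ ρ¹ ρ² σ τ u letters rep) s))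
      translate-correct (φ ∧̇ ψ) ρ¹ ρ² σ τ u letters rep = mk⇔ (λ (a , b) → to (translate-correct φ ρ¹ ρ² σ τ u letters rep) a , to (translate-correct ψ ρ¹ ρ² σ τ u letters rep) b)
                                          (λ (a , b) → from (translate-correct φ ρ¹ ρ² σ τ u letters rep) a , from (translate-correct ψ ρ¹ ρ² σ τ u letters rep) b)
      translate-correct (∃¹ φ) ρ¹ ρ² σ τ u letters (rep¹ , rep²) = mk⇔ sat⇒set set⇒sat
        where
        sat⇒set : Sat 𝓛 w Φ (∃¹ φ) σ τ → SatSet (translate (∃¹ φ) ρ¹ ρ²) u
        sat⇒set (x , sat-φ) = singleton x , from (singletonF⇔ em (cons u (singleton x)) zero) (x , singleton≡true⇔ x) ,
                      to (translate-correct φ (liftVar ρ¹) (λ x → suc (ρ² x)) (ext 𝓛 x σ) τ (cons u (singleton x)) letters (represents-ext¹ ρ¹ σ u x (singleton x) rep¹ (singleton≡true⇔ x) , rep²)) sat-φ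
        set⇒sat : SatSet (translate (∃¹ φ) ρ¹ ρ²) u → Sat 𝓛 w Φ (∃¹ φ) σ τ
        set⇒sat (Y , Y-single , s) = x , from (translate-correct φ (liftVar ρ¹) (λ x → suc (ρ² x)) (ext 𝓛 x σ) τ (cons u Y) letters (represents-ext¹ ρ¹ σ u x Y rep¹ x-single , rep²)) s
          where
          x = proj₁ (to (singletonF⇔ em (cons u Y) zero) Y-single)
          x-single = proj₂ (to (singletonF⇔ em (cons u Y) zero) Y-single)
      translate-correct (∃² φ) ρ¹ ρ² σ τ u letters (rep¹ , rep²) = mk⇔
        (λ (Y , s) → Y , to (translate-correct φ (λ x → suc (ρ¹ x)) (liftVar ρ²) σ (ext 𝓛 Y τ) (cons u Y) letters (rep¹ , represents-ext² ρ² τ u Y rep²)) s)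
        (λ (Y , s) → Y , from (translate-correct φ (λ x → suc (ρ¹ x)) (liftVar ρ²) σ (ext 𝓛 Y τ) (cons u Y) letters (rep¹ , represents-ext² ρ² τ u Y rep²)) s)


module MSOCombinators where

  open import Data.Nat using (ℕ; zero; suc)
  open import Data.Fin using (Fin; zero; suc)
  open import Data.Bool using (Bool)
  open import Data.Product using (Σ; _,_)
  open import Function using (_∘_)
  open import Function.Bundles using (_⇔_; mk⇔; Equivalence)
  open import Relation.Binary.PropositionalEquality using (_≡_; refl; sym; trans)
  open import Defs
  open Equivalence

  module _ {𝓜 : Structure} (𝓛 : Logic 𝓜) {m : ℕ} where
    open Structure 𝓜
    open Logic 𝓛

    ⊤F : ∀ {a b} → MSO 𝓛 m a b
    ⊤F = `0 ≐ `0

    ⋀F : ∀ {a b} k → (Fin k → MSO 𝓛 m a b) → MSO 𝓛 m a b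
    ⋀F zero f = ⊤F
    ⋀F (suc k) f = f zero ∧̇ ⋀F k (f ∘ suc)

    ⋁F : ∀ {a b} k → (Fin k → MSO 𝓛 m a b) → MSO 𝓛 m a b
    ⋁F k f = ¬̇ ⋀F k (¬̇_ ∘ f)

    ∀¹ : ∀ {a b} → MSO 𝓛 m (suc a) b → MSO 𝓛 m a b
    ∀¹ φ = ¬̇ ∃¹ (¬̇ φ)

    ∃ⁿ : ∀ {a} k → MSO 𝓛 m a k → MSO 𝓛 m a 0
    ∃ⁿ zero φ = φ
    ∃ⁿ (suc k) φ = ∃ⁿ k (∃² φ)

    module _ {n : ℕ} (w : ℕ → Fin n → Dom) (Φ : Fin m → Form n) where
      private
        S : ∀ {a b} → MSO 𝓛 m a b → (Fin a → ℕ) → (Fin b → ℕ → Bool) → Set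
        S = Sat 𝓛 w Φ

      ⋀F-sem : ∀ {a b} k (f : Fin k → MSO 𝓛 m a b) σ τ → S (⋀F k f) σ τ ⇔ (∀ i → S (f i) σ τ)
      ⋀F-sem zero f σ τ = mk⇔ (λ _ ()) (λ _ → refl)
      ⋀F-sem (suc k) f σ τ = mk⇔ (λ { (a , b) zero → a ; (a , b) (suc i) → to (⋀F-sem k (f ∘ suc) σ τ) b i })
                                 (λ g → g zero , from (⋀F-sem k (f ∘ suc) σ τ) (g ∘ suc))

      ⋁F-intro : ∀ {a b} k (f : Fin k → MSO 𝓛 m a b) σ τ i → S (f i) σ τ → S (⋁F k f) σ τ
      ⋁F-intro k f σ τ i s a = to (⋀F-sem k (¬̇_ ∘ f) σ τ) a i s

      Sat-cong² : ∀ {a b} (φ : MSO 𝓛 m a b) σ τ τ′ → (∀ y i → τ y i ≡ τ′ y i) → S φ σ τ → S φ σ τ′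
      Sat-cong² (s ≐ t) σ τ τ′ e x = x
      Sat-cong² (s ≺ t) σ τ τ′ e x = x
      Sat-cong² (t ∈̇ Y) σ τ τ′ e x = trans (sym (e Y _)) x
      Sat-cong² (P k t) σ τ τ′ e x = x
      Sat-cong² (¬̇ φ) σ τ τ′ e x s = x (Sat-cong² φ σ τ′ τ (λ y i → sym (e y i)) s)
      Sat-cong² (φ ∧̇ ψ) σ τ τ′ e (x , y) = Sat-cong² φ σ τ τ′ e x , Sat-cong² ψ σ τ τ′ e y
      Sat-cong² (∃¹ φ) σ τ τ′ e (x , s) = x , Sat-cong² φ (ext 𝓛 x σ) τ τ′ e s
      Sat-cong² (∃² φ) σ τ τ′ e (Y , s) = Y , Sat-cong² φ σ (ext 𝓛 Y τ) (ext 𝓛 Y τ′) e′ s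
        where
        e′ : ∀ y i → ext 𝓛 Y τ y i ≡ ext 𝓛 Y τ′ y i
        e′ zero i = refl
        e′ (suc y) i = e y i

      ∃ⁿ-sem : ∀ {a} k (φ : MSO 𝓛 m a k) σ τ₀ → S (∃ⁿ k φ) σ τ₀ ⇔ (Σ (Fin k → ℕ → Bool) λ E → S φ σ E)
      ∃ⁿ-sem zero φ σ τ₀ = mk⇔ (λ s → τ₀ , s) (λ (E , s) → Sat-cong² φ σ E τ₀ (λ ()) s)
      ∃ⁿ-sem (suc k) φ σ τ₀ = mk⇔
        (λ s → let (E , Y , s′) = to (∃ⁿ-sem k (∃² φ) σ τ₀) s in ext 𝓛 Y E , s′)
        (λ (E , s) → from (∃ⁿ-sem k (∃² φ) σ τ₀) (E ∘ suc , E zero , Sat-cong² φ σ E (ext 𝓛 (E zero) (E ∘ suc)) (split E) s))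
        where
        split : ∀ (E : Fin (suc k) → ℕ → Bool) y i → E y i ≡ ext 𝓛 (E zero) (E ∘ suc) y i
        split E zero i = refl
        split E (suc y) i = refl


module BüchiToMSO where

  open import Data.Nat using (ℕ; zero; suc; _≤_)
  open import Data.Nat.Properties using (<⇒≤)
  open import Data.Fin using (Fin; zero; suc)
  open import Data.Fin.Properties using (_≟_)
  open import Data.Bool using (Bool; true; false)
  open import Data.List using (length; lookup)
  open import Data.List.Membership.Propositional using (_∈_)
  open import Data.List.Membership.Propositional.Properties using (∈-lookup)
  open import Data.List.Relation.Unary.Any using (index)
  open import Data.List.Relation.Unary.Any.Properties using (lookup-index)
  open import Data.Product using (Σ; _×_; _,_; proj₁; proj₂)
  open import Data.Empty using (⊥-elim)
  open import Function using (_∘_)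
  open import Function.Bundles using (_⇔_; mk⇔; Equivalence)
  open import Relation.Binary.PropositionalEquality
  open import Relation.Nullary using (yes; no)
  open import Relation.Nullary.Decidable using (isYes)
  open import Defs
  open BoolEquations
  open MSOCombinators
  open Equivalence

  -- The letter predicates are the labels of the transitions, indexed by the position in Δ.
  module _ {𝓜 : Structure} (𝓛 : Logic 𝓜) {n : ℕ} (B : Büchi 𝓛 n) where
    open Structure 𝓜
    open Logic 𝓛
    open Büchi B

    nΔ : ℕ
    nΔ = length Δ

    label : Fin nΔ → Form n
    label δ = proj₁ (proj₂ (lookup Δ δ))

    source target : Fin nΔ → Fin nQ
    source δ = proj₁ (lookup Δ δ)
    target δ = proj₂ (proj₂ (lookup Δ δ))

    initialF : MSO 𝓛 nΔ 0 nQ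
    initialF = `0 ∈̇ q₀

    notBoth : Fin nQ → Fin nQ → MSO 𝓛 nΔ 1 nQ
    notBoth q q′ with q ≟ q′
    ... | yes _ = ⊤F 𝓛
    ... | no _ = ¬̇ ((var zero ∈̇ q) ∧̇ (var zero ∈̇ q′))

    uniqueStateAt : MSO 𝓛 nΔ 1 nQ
    uniqueStateAt = ⋁F 𝓛 nQ (λ q → var zero ∈̇ q) ∧̇ ⋀F 𝓛 nQ (λ q → ⋀F 𝓛 nQ (notBoth q))

    transitionAt : Fin nΔ → MSO 𝓛 nΔ 1 nQ
    transitionAt δ = (var zero ∈̇ source δ) ∧̇ (P δ (var zero) ∧̇ (`S (var zero) ∈̇ target δ))

    acceptingAt : Fin nQ → MSO 𝓛 nΔ 2 nQ
    acceptingAt q with acc q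
    ... | true = var zero ∈̇ q
    ... | false = ¬̇ ⊤F 𝓛

    acceptingLater : MSO 𝓛 nΔ 1 nQ
    acceptingLater = ∃¹ ((var (suc zero) ≺ var zero) ∧̇ ⋁F 𝓛 nQ acceptingAt)

    runF : MSO 𝓛 nΔ 0 nQ
    runF = initialF ∧̇ (∀¹ 𝓛 uniqueStateAt ∧̇ (∀¹ 𝓛 (⋁F 𝓛 nΔ transitionAt) ∧̇ ∀¹ 𝓛 acceptingLater))

    toMSO : MSOSentence 𝓛 n
    toMSO = record { m = nΔ ; Φ = label ; ψ = ∃ⁿ 𝓛 nQ runF }

    module _ (em : ExcludedMiddle) (w : ℕ → Fin n → Dom) where
      open Classical em

      S : ∀ {a b} → MSO 𝓛 nΔ a b → (Fin a → ℕ) → (Fin b → ℕ → Bool) → Set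
      S = Sat 𝓛 w label

      ∀¹-elim : ∀ {a b} (φ : MSO 𝓛 nΔ (suc a) b) σ τ → S (∀¹ 𝓛 φ) σ τ → ∀ x → S φ (ext 𝓛 x σ) τ
      ∀¹-elim φ σ τ s x = ¬¬-elim λ ¬s → s (x , ¬s)

      ∀¹-intro : ∀ {a b} (φ : MSO 𝓛 nΔ (suc a) b) σ τ → (∀ x → S φ (ext 𝓛 x σ) τ) → S (∀¹ 𝓛 φ) σ τ
      ∀¹-intro φ σ τ f (x , ¬s) = ¬s (f x)

      ⋁F-elim : ∀ {a b} k (f : Fin k → MSO 𝓛 nΔ a b) σ τ → S (⋁F 𝓛 k f) σ τ → Σ (Fin k) λ i → S (f i) σ τ
      ⋁F-elim k f σ τ s = ¬¬-elim λ ¬some → s (from (⋀F-sem 𝓛 w label k (¬̇_ ∘ f) σ τ) λ i si → ¬some (i , si))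

      acceptingAt-intro : ∀ q σ τ → acc q ≡ true → τ q (σ zero) ≡ true → S (acceptingAt q) σ τ
      acceptingAt-intro q σ τ a e with acc q
      ... | true = e

      acceptingAt-elim : ∀ q σ τ → S (acceptingAt q) σ τ → (acc q ≡ true) × (τ q (σ zero) ≡ true)
      acceptingAt-elim q σ τ s with acc q
      ... | true = refl , s
      ... | false = ⊥-elim (s refl)

      notBoth-intro : ∀ q q′ σ τ → (τ q (σ zero) ≡ true → τ q′ (σ zero) ≡ true → q ≡ q′) → S (notBoth q q′) σ τ
      notBoth-intro q q′ σ τ f with q ≟ q′
      ... | yes _ = refl
      ... | no q≢q′ = λ (a , b) → q≢q′ (f a b)

      notBoth-elim : ∀ q q′ σ τ → S (notBoth q q′) σ τ → τ q (σ zero) ≡ true → τ q′ (σ zero) ≡ true → q ≡ q′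
      notBoth-elim q q′ σ τ s a b with q ≟ q′
      ... | yes q≡q′ = q≡q′
      ... | no _ = ⊥-elim (s (a , b))

      run⇒runF : ∀ σ₀ → AcceptedBy 𝓛 B w → Σ (Fin nQ → ℕ → Bool) λ X → S runF σ₀ X
      run⇒runF σ₀ (ρ , (ρ0 , step) , infinitelyAcc) = X , initial , unique , transitions , accepting
        where
        X : Fin nQ → ℕ → Bool
        X q i = isYes (ρ i ≟ q)
        ρ∈X : ∀ i → X (ρ i) i ≡ true
        ρ∈X i = from (isYes≡true⇔ (ρ i ≟ ρ i)) refl
        X⇒ρ : ∀ q i → X q i ≡ true → ρ i ≡ q
        X⇒ρ q i e = to (isYes≡true⇔ (ρ i ≟ q)) e
        initial : S initialF σ₀ X
        initial = from (isYes≡true⇔ (ρ 0 ≟ q₀)) ρ0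
        unique : S (∀¹ 𝓛 uniqueStateAt) σ₀ X
        unique = ∀¹-intro uniqueStateAt σ₀ X λ x →
          ⋁F-intro 𝓛 w label nQ (λ q → var zero ∈̇ q) (ext 𝓛 x σ₀) X (ρ x) (ρ∈X x) ,
          from (⋀F-sem 𝓛 w label nQ (λ q → ⋀F 𝓛 nQ (notBoth q)) (ext 𝓛 x σ₀) X) λ q → from (⋀F-sem 𝓛 w label nQ (notBoth q) (ext 𝓛 x σ₀) X) λ q′ →
            notBoth-intro q q′ (ext 𝓛 x σ₀) X λ a b → trans (sym (X⇒ρ q x a)) (X⇒ρ q′ x b)
        transitions : S (∀¹ 𝓛 (⋁F 𝓛 nΔ transitionAt)) σ₀ X
        transitions = ∀¹-intro (⋁F 𝓛 nΔ transitionAt) σ₀ X λ x → let (φ , δ∈Δ , sat) = step x in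
          ⋁F-intro 𝓛 w label nΔ transitionAt (ext 𝓛 x σ₀) X (index δ∈Δ)
            ( subst (λ z → X z x ≡ true) (cong proj₁ (lookup-index δ∈Δ)) (ρ∈X x)
            , subst (w x ⊨_) (cong (proj₁ ∘ proj₂) (lookup-index δ∈Δ)) sat
            , subst (λ z → X z (suc x) ≡ true) (cong (proj₂ ∘ proj₂) (lookup-index δ∈Δ)) (ρ∈X (suc x)))
        accepting : S (∀¹ 𝓛 acceptingLater) σ₀ X
        accepting = ∀¹-intro acceptingLater σ₀ X λ x → let (j , x<j , a) = infinitelyAcc (suc x) in
          j , x<j , ⋁F-intro 𝓛 w label nQ acceptingAt (ext 𝓛 j (ext 𝓛 x σ₀)) X (ρ j) (acceptingAt-intro (ρ j) _ X a (ρ∈X j))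

      runF⇒run : ∀ σ₀ X → S runF σ₀ X → AcceptedBy 𝓛 B w
      runF⇒run σ₀ X (initial , unique , transitions , accepting) = ρ , (sym (ρ-unique 0 q₀ initial) , step) , infinitelyAcc
        where
        uniqueAt : ∀ x → S uniqueStateAt (ext 𝓛 x σ₀) X
        uniqueAt x = ∀¹-elim uniqueStateAt σ₀ X unique x
        someState : ∀ x → Σ (Fin nQ) λ q → X q x ≡ true
        someState x = ⋁F-elim nQ (λ q → var zero ∈̇ q) (ext 𝓛 x σ₀) X (proj₁ (uniqueAt x))
        ρ : ℕ → Fin nQ
        ρ x = proj₁ (someState x)
        ρ-unique : ∀ x q → X q x ≡ true → q ≡ ρ x
        ρ-unique x q e = notBoth-elim q (ρ x) (ext 𝓛 x σ₀) X
          (to (⋀F-sem 𝓛 w label nQ (notBoth q) (ext 𝓛 x σ₀) X) (to (⋀F-sem 𝓛 w label nQ (λ q → ⋀F 𝓛 nQ (notBoth q)) (ext 𝓛 x σ₀) X) (proj₂ (uniqueAt x)) q) (ρ x))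
          e (proj₂ (someState x))
        step : ∀ i → Σ (Form n) λ φ → ((ρ i , φ , ρ (suc i)) ∈ Δ) × (w i ⊨ φ)
        step i with ⋁F-elim nΔ transitionAt (ext 𝓛 i σ₀) X (∀¹-elim (⋁F 𝓛 nΔ transitionAt) σ₀ X transitions i)
        ... | δ , src , sat , tgt =
          label δ , subst (_∈ Δ) (cong₂ (λ x y → x , label δ , y) (ρ-unique i (source δ) src) (ρ-unique (suc i) (target δ) tgt)) (∈-lookup δ) , sat
        infinitelyAcc : ∀ i → Σ ℕ λ j → i ≤ j × acc (ρ j) ≡ true
        infinitelyAcc i with ∀¹-elim acceptingLater σ₀ X accepting i
        ... | y , i<y , later with ⋁F-elim nQ acceptingAt (ext 𝓛 y (ext 𝓛 i σ₀)) X later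
        ... | q , s with acceptingAt-elim q _ X s
        ... | a , e = y , <⇒≤ i<y , subst (λ z → acc z ≡ true) (ρ-unique y q e) a

      toMSO-correct : AcceptedBy 𝓛 B w ⇔ Models 𝓛 w toMSO
      toMSO-correct = mk⇔
        (λ run → from (∃ⁿ-sem 𝓛 w label nQ runF _ _) (run⇒runF _ run))
        (λ models → let (X , s) = to (∃ⁿ-sem 𝓛 w label nQ runF _ _) models in runF⇒run _ X s)


module MSOToBüchi where

  open import Data.Nat using (ℕ)
  open import Data.Fin using (Fin)
  open import Data.Bool using (Bool)
  open import Data.Vec using (Vec; [])
  open import Data.Product using (_,_)
  open import Function using (_∘_)
  open import Function.Bundles using (_⇔_)
  open import Function.Properties.Equivalence using (⇔-setoid; sym)
  open import Level using (0ℓ)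
  open import Defs
  open BooleanClosure using (comapR; comapR-recognizes)
  open SetMSO
  open ListAutomata using (module Automaton; AcceptsLA)
  open AutomatonOfRecognizer using (automaton-recognizes)
  open TypeAlphabet
  open EliminateFirstOrder
  open import Relation.Binary.Reasoning.Setoid (⇔-setoid 0ℓ)

  module _ {𝓜 : Structure} (𝓛 : Logic 𝓜) {n : ℕ} where
    open Structure 𝓜

    withoutSetVariables : ∀ {m} → Vec Bool m → Letter m 0
    withoutSetVariables a = a , []

    setFormula : (S : MSOSentence 𝓛 n) → SetFormula (MSOSentence.m S) 0
    setFormula S = translate 𝓛 (MSOSentence.Φ S) (MSOSentence.ψ S) (λ ()) (λ ())

    listAutomaton : (S : MSOSentence 𝓛 n) → ListAutomata.ListAutomaton (Vec Bool (MSOSentence.m S))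
    listAutomaton S = Automaton.automaton (comapR withoutSetVariables (recognizer (setFormula S)))

    toBüchiAutomaton : MSOSentence 𝓛 n → Büchi 𝓛 n
    toBüchiAutomaton S = toBüchi 𝓛 n (MSOSentence.Φ S) (listAutomaton S)

    toBüchiAutomaton-correct : ExcludedMiddle → ∀ S (w : ℕ → Fin n → Dom) → Models 𝓛 w S ⇔ AcceptedBy 𝓛 (toBüchiAutomaton S) w
    toBüchiAutomaton-correct em S w = begin
      Models 𝓛 w S
        ≈⟨ translate-correct 𝓛 Φ em w (MSOSentence.ψ S) (λ ()) (λ ()) _ _ u lettersMatch ((λ ()) , (λ ())) ⟩
      SatSet (setFormula S) u
        ≈⟨ automaton-recognizes em (comapR withoutSetVariables (recognizer (setFormula S))) _
             (comapR-recognizes withoutSetVariables (recognizer (setFormula S)) (SatSet (setFormula S)) (recognizer-recognizes em (setFormula S))) typeWord ⟩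
      AcceptsLA (listAutomaton S) typeWord
        ≈⟨ toBüchi-correct 𝓛 n Φ (listAutomaton S) em w ⟨
      AcceptedBy 𝓛 (toBüchiAutomaton S) w ∎
      where
      Φ = MSOSentence.Φ S
      typeWord = λ i → typeOf 𝓛 n em Φ (w i)
      u = withoutSetVariables ∘ typeWord
      lettersMatch : LettersMatch 𝓛 Φ em w u
      lettersMatch i k = sym (lookup-typeOf 𝓛 n em Φ (w i) k)


open import Data.Nat using (ℕ; _≤_)
open import Data.Fin using (Fin)
open import Data.Product using (Σ; _×_; _,_)
open import Function.Bundles using (_⇔_; mk⇔)
open import Function.Properties.Equivalence using (trans)
open import Defs
open MSOToBüchi using (toBüchiAutomaton; toBüchiAutomaton-correct)
open BüchiToMSO using (toMSO; toMSO-correct)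

module _ {𝓜 : Structure} (𝓛 : Logic 𝓜) {n : ℕ} where

  definable⇔recognizable :
    (toAut : MSOSentence 𝓛 n → Büchi 𝓛 n) → (∀ S w → Models 𝓛 w S ⇔ AcceptedBy 𝓛 (toAut S) w) →
    (toMSO : Büchi 𝓛 n → MSOSentence 𝓛 n) → (∀ B w → AcceptedBy 𝓛 B w ⇔ Models 𝓛 w (toMSO B)) →
    ∀ (R : ωRel (Structure.Dom 𝓜) n) → MSODefinable 𝓛 R ⇔ BüchiRecognizable 𝓛 R
  definable⇔recognizable toAut toAut-correct toMSO toMSO-correct R = mk⇔
    (λ (S , R⇔S) → toAut S , λ α → trans (R⇔S α) (toAut-correct S (conv α)))
    (λ (B , R⇔B) → toMSO B , λ α → trans (R⇔B α) (toMSO-correct B (conv α)))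

theorem3p8 : (𝓜 : Structure) (𝓛 : Logic 𝓜) (n : ℕ) → 1 ≤ n →
    Σ (MSOSentence 𝓛 n → Büchi 𝓛 n) λ toAut →
    Σ (Büchi 𝓛 n → MSOSentence 𝓛 n) λ toMSO →
      (ExcludedMiddle →
        ∀ (R : ωRel (Structure.Dom 𝓜) n) →
          MSODefinable 𝓛 R ⇔ BüchiRecognizable 𝓛 R)
      × (ExcludedMiddle → ∀ S (w : ℕ → Fin n → Structure.Dom 𝓜) →
           Models 𝓛 w S ⇔ AcceptedBy 𝓛 (toAut S) w)
      × (ExcludedMiddle → ∀ B (w : ℕ → Fin n → Structure.Dom 𝓜) →
           AcceptedBy 𝓛 B w ⇔ Models 𝓛 w (toMSO B))
theorem3p8 𝓜 𝓛 n _ =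
  toBüchiAutomaton 𝓛 , toMSO 𝓛 ,
  (λ em → definable⇔recognizable 𝓛 (toBüchiAutomaton 𝓛) (toBüchiAutomaton-correct 𝓛 em) (toMSO 𝓛) (λ B → toMSO-correct 𝓛 B em)) ,
  toBüchiAutomaton-correct 𝓛 ,
  (λ em B → toMSO-correct 𝓛 B em)
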